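{- Let $1\le k\le \ell\le r$ be integers, let $0\le e\le \ell r$, and let $B$ be any bipartite graph with a left part of $\ell$ vertices, a right part of $r$ vertices, and $e$ edges. Then $$m(B)\geq m(L_{\ell,r}(e))\quad\text{and}\quad m_k(B)\geq m_k(L_{\ell,r}(e)).$$
   Context: A matching in a graph is a set of pairwise non-incident edges (the empty set counts). $m(G)$ is the number of matchings of $G$ and $m_k(G)$ the number of matchings with exactly $k$ edges. For $\ell\le r$ and $e\le \ell r$ write $e=qr+c$ with $0\le c<r$. The lex bipartite graph $L_{\ell,r}(e)$ is the bipartite graph with parts $L$ of size $\ell$ and $R$ of size $r$ in which $q$ vertices of $L$ are adjacent to all of $R$, one further vertex of $L$ is adjacent to exactly $c$ vertices of $R$, and all other vertices of $L$ are isolated (so it has $e$ edges). -}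

module Defs where

open import Data.Nat using (ℕ; zero; suc; _+_; _*_; _≤_; _<_; _≡ᵇ_; _<ᵇ_)
open import Data.Nat.DivMod using (_/_; _%_)
open import Data.Bool using (Bool; true; false; _∧_; _∨_; not; if_then_else_)
open import Data.Fin using (Fin; toℕ)
open import Data.Vec using (Vec; []; _∷_; tabulate; foldr; zipWith; replicate)
open import Data.List using (List; []; _∷_; map; concatMap; length; filterᵇ)

-- A bipartite graph with left part L = Fin ℓ and right part R = Fin r,
-- given by its biadjacency matrix: row i, column j is true iff i ~ j.
BipGraph : ℕ → ℕ → Set
BipGraph ℓ r = Vec (Vec Bool r) ℓ

countTrue : ∀ {n} → Vec Bool n → ℕ
countTrue = foldr _ (λ b n → (if b then 1 else 0) + n) 0

edges : ∀ {ℓ r} → BipGraph ℓ r → ℕ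
edges = foldr _ (λ row n → countTrue row + n) 0

atMostOne : ∀ {n} → Vec Bool n → Bool
atMostOne v = countTrue v <ᵇ 2

allB : ∀ {n} → Vec Bool n → Bool
allB = foldr _ _∧_ true

transpose : ∀ {ℓ r} → Vec (Vec Bool r) ℓ → Vec (Vec Bool ℓ) r
transpose {r = r} [] = replicate r []
transpose (row ∷ rows) = zipWith _∷_ row (transpose rows)

subgraph : ∀ {ℓ r} → BipGraph ℓ r → BipGraph ℓ r → Bool
subgraph M G = allB (zipWith (λ u v → allB (zipWith (λ a b → not a ∨ b) u v)) M G)

isMatching : ∀ {ℓ r} → BipGraph ℓ r → BipGraph ℓ r → Bool
isMatching M G = subgraph M G ∧ allB (Data.Vec.map atMostOne M)
                              ∧ allB (Data.Vec.map atMostOne (transpose M))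

allVecs : (n : ℕ) → List (Vec Bool n)
allVecs zero = [] ∷ []
allVecs (suc n) = concatMap (λ v → (false ∷ v) ∷ (true ∷ v) ∷ []) (allVecs n)

allMatrices : (ℓ r : ℕ) → List (Vec (Vec Bool r) ℓ)
allMatrices zero r = [] ∷ []
allMatrices (suc ℓ) r =
  concatMap (λ rows → map (λ row → row ∷ rows) (allVecs r)) (allMatrices ℓ r)

-- all matchings of G (including the empty one)
matchings : ∀ {ℓ r} → BipGraph ℓ r → List (BipGraph ℓ r)
matchings {ℓ} {r} G = filterᵇ (λ M → isMatching M G) (allMatrices ℓ r)

m : ∀ {ℓ r} → BipGraph ℓ r → ℕ
m G = length (matchings G)

mk : ∀ {ℓ r} → ℕ → BipGraph ℓ r → ℕ
mk k G = length (filterᵇ (λ M → edges M ≡ᵇ k) (matchings G))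

-- The lex bipartite graph L_{ℓ,r}(e): with e = q r + c, 0 ≤ c < r,
-- left vertices i < q are adjacent to all of R, left vertex q is adjacent
-- to the right vertices j < c, all others isolated.
-- (For r = 0 there are no right vertices; the graph is empty.)
Lex : (ℓ r e : ℕ) → BipGraph ℓ r
Lex ℓ zero e = replicate ℓ []
Lex ℓ (suc r') e = tabulate λ i → tabulate λ j →
  (toℕ i <ᵇ q) ∨ ((toℕ i ≡ᵇ q) ∧ (toℕ j <ᵇ c))
  where
  q = e / suc r'
  c = e % suc r'

-- Matchings are counted row by row: `avoiding k U G` is the number of k-matchings of
-- the rows G that use no right vertex of U. This count does not depend on the order of
-- the rows, decreases as U grows, and satisfies the column identity
-- Σⱼ avoiding k (U ∪ {j}) = (r - k) avoiding k U; together these give the greedy bound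
-- for adding a row of degree M: avoiding (k+1) (row ∷ G) ≥ avoiding (k+1) G + (M - k) avoiding k G.
-- For the lex graph on d+1 right vertices with e = q(d+1) + c edges the count is
-- explicit, C(q,k) (d+1)^(k) + c C(q,k-1) d^(k-1) with falling powers, and satisfies two
-- inequalities: for e ≤ (d+1)² extra right vertices never help, and adding a row of
-- M ≤ d+1 edges together with one right vertex gains at most what the greedy bound
-- provides. Induction on the number of rows, removing a row of maximum degree, then
-- shows that the lex graph has the fewest k-matchings among graphs with at most d+1 rows
-- of degree at most d+1. Finally m_k of the statement, defined by enumerating 0/1
-- matrices, is identified with `avoiding k ∅`, the lex graph of the statement is
-- evaluated, and m is the sum of the m_k.
module Submission where

open import Defs
open import Data.Nat using (ℕ; zero; suc; _*_; _≤_)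
open import Data.Nat.Properties using (≤-trans; module ≤-Reasoning)
open import Data.Fin using (toℕ)
open import Data.Fin.Subset using (⊥)
open import Data.Product using (_×_; _,_)
open import Relation.Nullary using (contradiction)
open import Relation.Binary.PropositionalEquality using (_≡_; refl; sym; subst₂)

module Sums where
  open import Data.Nat
  open import Data.Nat.Properties
  open import Data.Bool using (Bool; true; false; not; _∧_)
  open import Data.Fin using (Fin; zero; suc)
  open import Data.Fin.Properties using () renaming (_≟_ to _≟ᶠ_)
  open import Relation.Nullary using (does)
  open import Relation.Binary.PropositionalEquality

  open import Algebra.Properties.Semiring.Sum +-*-semiring public
    using (sum; sum-syntax; ∑-distrib-+; ∑-comm; sum-cong-≗; *-distribˡ-sum)

  infixr 8 [_]·_
  [_]·_ : Bool → ℕ → ℕ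
  [ true ]· x = x
  [ false ]· x = 0

  []·-distrib-+ : ∀ b x y → [ b ]· (x + y) ≡ [ b ]· x + [ b ]· y
  []·-distrib-+ true x y = refl
  []·-distrib-+ false x y = refl

  []·-comm-* : ∀ b a x → [ b ]· (a * x) ≡ a * [ b ]· x
  []·-comm-* true a x = refl
  []·-comm-* false a x = sym (*-zeroʳ a)

  []·-∧ : ∀ b c x → [ b ]· [ c ]· x ≡ [ b ∧ c ]· x
  []·-∧ true c x = refl
  []·-∧ false c x = refl

  []·-as-* : ∀ b x → [ b ]· x ≡ x * [ b ]· 1
  []·-as-* true x = sym (*-identityʳ x)
  []·-as-* false x = sym (*-zeroʳ x)

  []·-split : ∀ b x → [ b ]· x + [ not b ]· x ≡ x
  []·-split true x = +-identityʳ x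
  []·-split false x = refl

  []·-mono : ∀ {b b' x y} → (b ≡ true → b' ≡ true) → x ≤ y → [ b ]· x ≤ [ b' ]· y
  []·-mono {false} _ _ = z≤n
  []·-mono {true} h x≤y rewrite h refl = x≤y

  sum-const : ∀ {n} x → sum {n} (λ _ → x) ≡ n * x
  sum-const {zero} x = refl
  sum-const {suc n} x = cong (x +_) (sum-const {n} x)

  sum-zero : ∀ {n} {f : Fin n → ℕ} → (∀ i → f i ≡ 0) → sum f ≡ 0
  sum-zero {n} {f} f≡0 = trans (sum-cong-≗ {n} {f} f≡0) (trans (sum-const {n} 0) (*-zeroʳ n))

  sum-mono : ∀ {n} {f g : Fin n → ℕ} → (∀ i → f i ≤ g i) → sum f ≤ sum g
  sum-mono {zero} _ = z≤n
  sum-mono {suc n} f≤g = +-mono-≤ (f≤g zero) (sum-mono (λ i → f≤g (suc i)))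

  []·-sum : ∀ {n} b (f : Fin n → ℕ) → [ b ]· sum f ≡ sum (λ i → [ b ]· f i)
  []·-sum true f = refl
  []·-sum {n} false f = sym (sum-zero {n} (λ _ → refl))

  sum-δ : ∀ {n} (i : Fin n) x → sum (λ j → [ does (i ≟ᶠ j) ]· x) ≡ x
  sum-δ {suc n} zero x = trans (cong (x +_) (sum-zero {n} (λ _ → refl))) (+-identityʳ x)
  sum-δ {suc n} (suc i) x = sum-δ i x

-- The explicit count of k-matchings of lex graphs and the arithmetic inequalities it satisfies.
module LexCounting where
  open import Data.Nat
  open import Data.Nat.Properties
  open import Data.Nat.DivMod
  open import Relation.Nullary using (yes; no; contradiction)
  open import Data.Nat.Tactic.RingSolver using (solve-∀)
  open import Relation.Binary.PropositionalEquality
  open import Data.Product using (∃; _,_; _×_)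

  -- falling n k = n (n-1) ⋯ (n-k+1): injective placements of k items into n slots.
  falling : ℕ → ℕ → ℕ
  falling n zero = 1
  falling zero (suc k) = 0
  falling (suc n) (suc k) = suc n * falling n k

  choose : ℕ → ℕ → ℕ
  choose q zero = 1
  choose zero (suc k) = 0
  choose (suc q) (suc k) = choose q k + choose q (suc k)

  choose-1 : ∀ q → choose q 1 ≡ q
  choose-1 zero = refl
  choose-1 (suc q) = cong suc (choose-1 q)

  choose-above : ∀ {q k} → q < k → choose q k ≡ 0
  choose-above {zero} {suc k} _ = refl
  choose-above {suc q} {suc (suc k)} (s≤s q<k) =
    cong₂ _+_ (choose-above q<k) (choose-above (m<n⇒m<1+n q<k))

  -- Absorption identities for the falling power n^(i) = falling n i and for binomials:
  -- (n-i) n^(i) = n^(i+1) and (i+1) C(q,i+1) = (q-i) C(q,i), without truncated subtraction.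
  falling-absorb : ∀ n i → falling n (suc i) + i * falling n i ≡ n * falling n i
  falling-absorb zero zero = refl
  falling-absorb zero (suc i) = *-zeroʳ (suc i)
  falling-absorb (suc n) zero = +-identityʳ _
  falling-absorb (suc n) (suc i) = begin
    suc n * A + suc i * (suc n * B)  ≡⟨ regroup n i A B ⟩
    suc n * (A + i * B + B)          ≡⟨ cong (λ x → suc n * (x + B)) (falling-absorb n i) ⟩
    suc n * (n * B + B)              ≡⟨ cong (suc n *_) (+-comm (n * B) B) ⟩
    suc n * (suc n * B)              ∎
    where
    open ≡-Reasoning
    A = falling n (suc i)
    B = falling n i
    regroup : ∀ n i a b → suc n * a + suc i * (suc n * b) ≡ suc n * (a + i * b + b)
    regroup = solve-∀

  choose-absorb : ∀ q i → suc i * choose q (suc i) + i * choose q i ≡ q * choose q i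
  choose-absorb zero zero = refl
  choose-absorb zero (suc i) = cong₂ _+_ (*-zeroʳ (suc (suc i))) (*-zeroʳ (suc i))
  choose-absorb (suc q) zero =
    trans (+-identityʳ _) (trans (*-identityˡ _) (trans (choose-1 (suc q)) (sym (*-identityʳ (suc q)))))
  choose-absorb (suc q) (suc i) = begin
    (2 + i) * (b + d) + (1 + i) * (a + b)                 ≡⟨ regroup i a b d ⟩
    ((2 + i) * d + (1 + i) * b) + b + a + ((1 + i) * b + i * a)
      ≡⟨ cong₂ (λ x y → x + b + a + y) (choose-absorb q (suc i)) (choose-absorb q i) ⟩
    q * b + b + a + q * a                                 ≡⟨ collect q a b ⟩
    suc q * (a + b)                                       ∎
    where
    open ≡-Reasoning
    a = choose q i
    b = choose q (suc i)
    d = choose q (suc (suc i))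
    regroup : ∀ i a b d → (2 + i) * (b + d) + (1 + i) * (a + b)
                          ≡ ((2 + i) * d + (1 + i) * b) + b + a + ((1 + i) * b + i * a)
    regroup = solve-∀
    collect : ∀ q a b → q * b + b + a + q * a ≡ suc q * (a + b)
    collect = solve-∀

  falling-suc : ∀ n k → falling n (suc k) ≡ (n ∸ k) * falling n k
  falling-suc n k = begin
    falling n (suc k)                              ≡⟨ m+n∸n≡m _ (k * falling n k) ⟨
    falling n (suc k) + k * falling n k ∸ k * falling n k ≡⟨ cong (_∸ k * falling n k) (falling-absorb n k) ⟩
    n * falling n k ∸ k * falling n k              ≡⟨ *-distribʳ-∸ (falling n k) n k ⟨
    (n ∸ k) * falling n k                          ∎
    where open ≡-Reasoning

  -- lexCount D k q c is the number of k-matchings of the bipartite graph on D right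
  -- vertices having q left vertices joined to every right vertex and one further left
  -- vertex joined to c ≤ D of them: either all k edges start at complete rows, or k-1 do
  -- and the last one is one of the c edges of the partial row.
  lexCount : ℕ → ℕ → ℕ → ℕ → ℕ
  lexCount D zero q c = 1
  lexCount D (suc j) q c = choose q (suc j) * falling D (suc j) + c * (choose q j * falling (pred D) j)

  -- Adding a complete row: a (j+1)-matching either avoids the new row or matches it to
  -- one of the D - j right vertices left free by a j-matching of the rest.
  lexCount-addRow : ∀ d j q c →
    lexCount (suc d) (suc j) (suc q) c ≡ lexCount (suc d) (suc j) q c + (suc d ∸ j) * lexCount (suc d) j q c
  lexCount-addRow d zero q c = regroup (suc d) (choose q 1) c
    where
    regroup : ∀ D a c → (1 + a) * (D * 1) + c * (1 * 1) ≡ a * (D * 1) + c * (1 * 1) + D * 1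
    regroup = solve-∀
  lexCount-addRow d (suc i) q c rewrite falling-suc (suc d) (suc i) | falling-suc d i =
    regroup (d ∸ i) (choose q i) (choose q (suc i)) (choose q (suc (suc i))) c (falling (suc d) (suc i)) (falling d i)
    where
    regroup : ∀ x a b d c F G → (b + d) * (x * F) + c * ((a + b) * (x * G))
                                ≡ d * (x * F) + c * (b * (x * G)) + x * (b * F + c * (a * G))
    regroup = solve-∀

  -- The shape of every lexCount comparison below: an exact identity X + K ≡ (Y + W) + K'
  -- (checked by ring normalisation) whose correction terms K, K' agree by the
  -- hypotheses, so that X exceeds Y by the slack W.
  ≤-by-balance : ∀ {X Y W K K'} → X + K ≡ (Y + W) + K' → K ≡ K' → Y ≤ X
  ≤-by-balance {X} {Y} {W} {K} balance K≡K' =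
    subst (Y ≤_) (sym (+-cancelʳ-≡ K X (Y + W) (trans balance (cong (Y + W +_) (sym K≡K')))))
      (m≤m+n Y W)

  -- "Either the partial row of an e-edge lex graph is empty or there is room for one more
  -- complete row": ∃ t. c (q + 1 + t) = c M, i.e. c = 0 or q < M.
  Room : ℕ → ℕ → ℕ → Set
  Room c q M = ∃ λ t → c * (q + 1 + t) ≡ c * M

  -- Throughout, n+1 (resp. n+2) is the number of right
  -- vertices, q the number of complete rows and c (resp. C) the size of the partial row;
  -- in the proofs P = n^(i), F = n^(i+1) are falling powers and bₓ = C(q, i+x).

  -- Widening without a carry: c + q(n+1) = C + q(n+2). Slack: C(q,i+1) (i+1) n^(i) (n+1-c).
  lexCount-widen : ∀ n i q c s C → q + C ≡ c → c + s ≡ suc n →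
    lexCount (suc (suc n)) (suc (suc i)) q C ≤ lexCount (suc n) (suc (suc i)) q c
  lexCount-widen n i q c s C q+C≡c c+s≡n =
    ≤-by-balance (balance n i q c s C P F b₁ b₂)
      (cong₂ _+_ (cong (suc n * P *_) (choose-absorb q (suc i)))
      (cong₂ _+_ (cong ((b₂ * suc n + c * b₁) *_) (sym (falling-absorb n i)))
      (cong₂ _+_ (cong (b₁ * suc n * P *_) q+C≡c)
                 (cong (b₁ * (1 + i) * P *_) c+s≡n))))
    where
    P = falling n i ; F = falling n (suc i) ; b₁ = choose q (suc i) ; b₂ = choose q (suc (suc i))
    balance : ∀ (n i q c s C P F b₁ b₂ : ℕ) →
      (b₂ * (suc n * F) + c * (b₁ * F))
      + ((suc n * P) * ((2 + i) * b₂ + (1 + i) * b₁)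
       + ((b₂ * suc n + c * b₁) * (n * P)
       + ((b₁ * suc n * P) * (q + C)
       + (b₁ * (1 + i) * P) * (c + s))))
      ≡ (b₂ * (suc (suc n) * (suc n * P)) + C * (b₁ * (suc n * P)) + b₁ * (1 + i) * P * s)
      + ((suc n * P) * (q * b₁)
       + ((b₂ * suc n + c * b₁) * (F + i * P)
       + ((b₁ * suc n * P) * c
       + (b₁ * (1 + i) * P) * suc n)))
    balance = solve-∀

  -- Widening with a carry: c + (q+1)(n+1) = C + q(n+2). Slack: c n^(i) C(q,i) t.
  lexCount-widen-carry : ∀ n i q c C → C + q ≡ c + suc n → Room c q (suc n) →
    lexCount (suc (suc n)) (suc (suc i)) q C ≤ lexCount (suc n) (suc (suc i)) (suc q) c
  lexCount-widen-carry n i q c C C+q≡c+n (t , room) =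
    ≤-by-balance (balance n i q c t C P F b₀ b₁ b₂)
      (cong₂ _+_ (cong (suc n * P *_) (choose-absorb q (suc i)))
      (cong₂ _+_ (cong (c * P *_) (choose-absorb q i))
      (cong₂ _+_ (cong (((b₁ + b₂) * suc n + c * (b₀ + b₁)) *_) (sym (falling-absorb n i)))
      (cong₂ _+_ (cong (b₁ * suc n * P *_) C+q≡c+n)
                 (cong (P * b₀ *_) room)))))
    where
    P = falling n i ; F = falling n (suc i)
    b₀ = choose q i ; b₁ = choose q (suc i) ; b₂ = choose q (suc (suc i))
    balance : ∀ (n i q c t C P F b₀ b₁ b₂ : ℕ) →
      ((b₁ + b₂) * (suc n * F) + c * ((b₀ + b₁) * F))
      + ((suc n * P) * ((2 + i) * b₂ + (1 + i) * b₁)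
       + ((c * P) * ((1 + i) * b₁ + i * b₀)
       + (((b₁ + b₂) * suc n + c * (b₀ + b₁)) * (n * P)
       + ((b₁ * suc n * P) * (C + q)
       + (P * b₀) * (c * (q + 1 + t))))))
      ≡ (b₂ * (suc (suc n) * (suc n * P)) + C * (b₁ * (suc n * P)) + c * P * b₀ * t)
      + ((suc n * P) * (q * b₁)
       + ((c * P) * (q * b₀)
       + (((b₁ + b₂) * suc n + c * (b₀ + b₁)) * (F + i * P)
       + ((b₁ * suc n * P) * (c + suc n)
       + (P * b₀) * (c * suc n)))))
    balance = solve-∀

  -- Adding a row of M = i+1+u edges without a carry: (c + q(n+1)) + M = C + q(n+2).
  -- Slack: c n^(i) C(q,i) t.
  lexCount-extend : ∀ n i q c u C → q + C ≡ c + (suc i + u) → Room c q (suc i + u) →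
    lexCount (suc (suc n)) (suc (suc i)) q C
      ≤ lexCount (suc n) (suc (suc i)) q c + u * lexCount (suc n) (suc i) q c
  lexCount-extend n i q c u C q+C≡c+M (t , room) =
    ≤-by-balance (balance n i q c u t C P F b₀ b₁ b₂)
      (cong₂ _+_ (cong (suc n * P *_) (choose-absorb q (suc i)))
      (cong₂ _+_ (cong (c * P *_) (choose-absorb q i))
      (cong₂ _+_ (cong ((b₂ * suc n + c * b₁) *_) (sym (falling-absorb n i)))
      (cong₂ _+_ (cong (b₁ * suc n * P *_) q+C≡c+M)
                 (cong (P * b₀ *_) room)))))
    where
    P = falling n i ; F = falling n (suc i)
    b₀ = choose q i ; b₁ = choose q (suc i) ; b₂ = choose q (suc (suc i))
    balance : ∀ (n i q c u t C P F b₀ b₁ b₂ : ℕ) →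
      (b₂ * (suc n * F) + c * (b₁ * F) + u * (b₁ * (suc n * P) + c * (b₀ * P)))
      + ((suc n * P) * ((2 + i) * b₂ + (1 + i) * b₁)
       + ((c * P) * ((1 + i) * b₁ + i * b₀)
       + ((b₂ * suc n + c * b₁) * (n * P)
       + ((b₁ * suc n * P) * (q + C)
       + (P * b₀) * (c * (q + 1 + t))))))
      ≡ (b₂ * (suc (suc n) * (suc n * P)) + C * (b₁ * (suc n * P)) + c * P * b₀ * t)
      + ((suc n * P) * (q * b₁)
       + ((c * P) * (q * b₀)
       + ((b₂ * suc n + c * b₁) * (F + i * P)
       + ((b₁ * suc n * P) * (c + (suc i + u))
       + (P * b₀) * (c * (suc i + u))))))
    balance = solve-∀

  -- Adding a row of M = i+1+u edges with a carry: (c + q(n+1)) + M = C + (q+1)(n+2).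
  -- Slack: n^(i) C(q,i) (n+1-c) (n+q+2-M).
  lexCount-extend-carry : ∀ n i q c u s w C → C + q + suc n + 1 ≡ c + (suc i + u) →
    (suc i + u) + w ≡ suc n + q + 1 → c + s ≡ suc n →
    lexCount (suc (suc n)) (suc (suc i)) (suc q) C
      ≤ lexCount (suc n) (suc (suc i)) q c + u * lexCount (suc n) (suc i) q c
  lexCount-extend-carry n i q c u s w C carried M+w≡n+q c+s≡n =
    ≤-by-balance (balance n i q c u s w C P F b₀ b₁ b₂)
      (cong₂ _+_ (cong (suc n * P *_) (choose-absorb q (suc i)))
      (cong₂ _+_ (cong (c * P *_) (choose-absorb q i))
      (cong₂ _+_ (cong ((b₂ * suc n + c * b₁) *_) (sym (falling-absorb n i)))
      (cong₂ _+_ (cong ((b₀ + b₁) * suc n * P *_) carried)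
      (cong₂ _+_ (cong₂ _+_ (cong (P * b₀ * c *_) (sym M+w≡n+q)) (cong (P * b₀ * suc n *_) M+w≡n+q))
                 (cong (P * b₀ * w *_) c+s≡n))))))
    where
    P = falling n i ; F = falling n (suc i)
    b₀ = choose q i ; b₁ = choose q (suc i) ; b₂ = choose q (suc (suc i))
    balance : ∀ (n i q c u s w C P F b₀ b₁ b₂ : ℕ) →
      (b₂ * (suc n * F) + c * (b₁ * F) + u * (b₁ * (suc n * P) + c * (b₀ * P)))
      + ((suc n * P) * ((2 + i) * b₂ + (1 + i) * b₁)
       + ((c * P) * ((1 + i) * b₁ + i * b₀)
       + ((b₂ * suc n + c * b₁) * (n * P)
       + (((b₀ + b₁) * suc n * P) * (C + q + suc n + 1)
       + ((P * b₀ * c) * (suc n + q + 1) + (P * b₀ * suc n) * ((suc i + u) + w)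
       + (P * b₀ * w) * (c + s))))))
      ≡ ((b₁ + b₂) * (suc (suc n) * (suc n * P)) + C * ((b₀ + b₁) * (suc n * P)) + P * b₀ * s * w)
      + ((suc n * P) * (q * b₁)
       + ((c * P) * (q * b₀)
       + ((b₂ * suc n + c * b₁) * (F + i * P)
       + (((b₀ + b₁) * suc n * P) * (c + (suc i + u))
       + ((P * b₀ * c) * ((suc i + u) + w) + (P * b₀ * suc n) * (suc n + q + 1)
       + (P * b₀ * w) * suc n)))))
    balance = solve-∀

  digits-unique : ∀ d e q c → c < suc d → e ≡ c + q * suc d → e / suc d ≡ q × e % suc d ≡ c
  digits-unique d e q c c<d e≡ = quot≡ , rem≡
    where
    open ≡-Reasoning
    rem≡ : e % suc d ≡ c
    rem≡ = begin
      e % suc d               ≡⟨ cong (_% suc d) e≡ ⟩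
      (c + q * suc d) % suc d ≡⟨ [m+kn]%n≡m%n c q (suc d) ⟩
      c % suc d               ≡⟨ m<n⇒m%n≡m c<d ⟩
      c                       ∎
    quot≡ : e / suc d ≡ q
    quot≡ = *-cancelʳ-≡ (e / suc d) q (suc d) (+-cancelˡ-≡ c _ _ (begin
      c + e / suc d * suc d         ≡⟨ cong (_+ e / suc d * suc d) rem≡ ⟨
      e % suc d + e / suc d * suc d ≡⟨ m≡m%n+[m/n]*n e (suc d) ⟨
      e                             ≡⟨ e≡ ⟩
      c + q * suc d                 ∎))

  quotient-bound : ∀ n q m e c → e ≡ c + q * suc n → e ≤ suc n * m → q ≤ m
  quotient-bound n q m e c e≡ e≤ = *-cancelʳ-≤ q m (suc n) (begin
    q * suc n     ≤⟨ m≤n+m (q * suc n) c ⟩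
    c + q * suc n ≡⟨ e≡ ⟨
    e             ≤⟨ e≤ ⟩
    suc n * m     ≡⟨ *-comm (suc n) m ⟩
    m * suc n     ∎)
    where open ≤-Reasoning

  remainder-zero : ∀ n q e c → e ≡ c + q * suc n → e ≤ suc n * q → c ≡ 0
  remainder-zero n q e c e≡ e≤ = n≤0⇒n≡0 (+-cancelʳ-≤ (q * suc n) c 0 (begin
    c + q * suc n ≡⟨ e≡ ⟨
    e             ≤⟨ e≤ ⟩
    suc n * q     ≡⟨ *-comm (suc n) q ⟩
    q * suc n     ∎))
    where open ≤-Reasoning

  room : ∀ n M e q c → e ≡ c + q * suc n → e ≤ suc n * M → Room c q M
  room n M e q c e≡ e≤ with q <? M
  ... | yes q<M with m≤n⇒∃[o]m+o≡n q<M
  ...   | t , q+t≡M = t , cong (c *_) (trans (cong (_+ t) (+-comm q 1)) q+t≡M)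
  room n M e q c e≡ e≤ | no q≮M with ≤-antisym (quotient-bound n q M e c e≡ e≤) (≮⇒≥ q≮M)
  ... | refl = 0 , subst (λ x → x * (q + 1 + 0) ≡ x * q) (sym (remainder-zero n q e c e≡ e≤)) refl

  Room-pred : ∀ c q M → Room c (suc q) (suc M) → Room c q M
  Room-pred c q M (t , r) =
    t , +-cancelˡ-≡ c _ _ (trans (sym (*-suc c (q + 1 + t))) (trans r (*-suc c M)))

  -- lexMatchings d k e is the number of k-matchings of the lex graph with e edges on
  -- d+1 right vertices.
  lexMatchings : ℕ → ℕ → ℕ → ℕ
  lexMatchings d k e = lexCount (suc d) k (e / suc d) (e % suc d)

  lexMatchings-digits : ∀ d k e q c → c < suc d → e ≡ c + q * suc d →
    lexMatchings d k e ≡ lexCount (suc d) k q c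
  lexMatchings-digits d k e q c c<d e≡ with digits-unique d e q c c<d e≡
  ... | quot≡ , rem≡ = cong₂ (lexCount (suc d) k) quot≡ rem≡

  lexMatchings-1 : ∀ d e → lexMatchings d 1 e ≡ e
  lexMatchings-1 d e
    rewrite choose-1 (e / suc d) | *-identityʳ (suc d) | *-identityʳ (e % suc d) =
    trans (+-comm (e / suc d * suc d) (e % suc d)) (sym (m≡m%n+[m/n]*n e (suc d)))

  lexMatchings-empty : ∀ d k → lexMatchings d (suc k) 0 ≡ 0
  lexMatchings-empty d k rewrite lexMatchings-digits d (suc k) 0 0 0 (s≤s z≤n) refl = refl

  lexMatchings-addRow : ∀ d j e →
    lexMatchings d (suc j) (e + suc d) ≡ lexMatchings d (suc j) e + (suc d ∸ j) * lexMatchings d j e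
  lexMatchings-addRow d j e =
    trans (lexMatchings-digits d (suc j) (e + suc d) (suc q) c (m%n<n e (suc d)) digits+row)
          (lexCount-addRow d j q c)
    where
    q = e / suc d
    c = e % suc d
    shift : ∀ c q d → c + q * suc d + suc d ≡ c + suc q * suc d
    shift = solve-∀
    digits+row : e + suc d ≡ c + suc q * suc d
    digits+row = trans (cong (_+ suc d) (m≡m%n+[m/n]*n e (suc d))) (shift c q d)

  -- An extra right vertex never increases the number of matchings of a lex graph with
  -- at most (d+1)(d+2) edges; on digits: widen the base from d+1 to d+2.
  lexMatchings-widen-digits : ∀ d i e q c → c < suc d → e ≡ c + q * suc d → e ≤ suc d * suc (suc d) →
    lexMatchings (suc d) (suc (suc i)) e ≤ lexCount (suc d) (suc (suc i)) q c
  lexMatchings-widen-digits d i e q c c<d e≡ e≤ with q ≤? c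
  ... | yes q≤c = noCarry (m≤n⇒∃[o]m+o≡n q≤c) (m≤n⇒∃[o]m+o≡n (<⇒≤ c<d))
    where
    rebase : ∀ q C d → (q + C) + q * suc d ≡ C + q * suc (suc d)
    rebase = solve-∀
    noCarry : (∃ λ C → q + C ≡ c) → (∃ λ s → c + s ≡ suc d) →
              lexMatchings (suc d) (suc (suc i)) e ≤ lexCount (suc d) (suc (suc i)) q c
    noCarry (C , q+C≡c) (s , c+s≡d) =
      subst (_≤ lexCount (suc d) (suc (suc i)) q c)
        (sym (lexMatchings-digits (suc d) (suc (suc i)) e q C C<
          (trans e≡ (trans (cong (_+ q * suc d) (sym q+C≡c)) (rebase q C d)))))
        (lexCount-widen d i q c s C q+C≡c c+s≡d)
      where
      C< : C < suc (suc d)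
      C< = ≤-trans (s≤s (≤-trans (m≤n+m C q) (≤-reflexive q+C≡c))) (m≤n⇒m≤1+n c<d)
  lexMatchings-widen-digits d i e zero c c<d e≡ e≤ | no q≰c = contradiction z≤n q≰c
  lexMatchings-widen-digits d i e (suc q) c c<d e≡ e≤ | no q≰c =
    carry (m≤n⇒∃[o]m+o≡n (≤-trans q≤d (m≤n+m (suc d) c)))
    where
    q≤d : q ≤ suc d
    q≤d = ≤-pred (quotient-bound d (suc q) (suc (suc d)) e c e≡ e≤)
    rebase : ∀ c q C d → c + suc d ≡ q + C → c + suc q * suc d ≡ C + q * suc (suc d)
    rebase c q C d h = trans (regroup₁ d c q) (trans (cong (_+ q * suc d) h) (regroup₂ q C d))
      where
      regroup₁ : ∀ d c q → c + suc q * suc d ≡ (c + suc d) + q * suc d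
      regroup₁ = solve-∀
      regroup₂ : ∀ q C d → (q + C) + q * suc d ≡ C + q * suc (suc d)
      regroup₂ = solve-∀
    carry : (∃ λ C → q + C ≡ c + suc d) →
            lexMatchings (suc d) (suc (suc i)) e ≤ lexCount (suc d) (suc (suc i)) (suc q) c
    carry (C , q+C≡c+d) =
      subst (_≤ lexCount (suc d) (suc (suc i)) (suc q) c)
        (sym (lexMatchings-digits (suc d) (suc (suc i)) e q C C<
          (trans e≡ (rebase c q C d (sym q+C≡c+d)))))
        (lexCount-widen-carry d i q c C (trans (+-comm C q) q+C≡c+d)
          (Room-pred c q (suc d) (room d (suc (suc d)) e (suc q) c e≡ e≤)))
      where
      C< : C < suc (suc d)
      C< = s≤s (+-cancelˡ-≤ q C (suc d) (begin
        q + C     ≡⟨ q+C≡c+d ⟩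
        c + suc d ≤⟨ +-monoˡ-≤ (suc d) (≤-pred (≰⇒> q≰c)) ⟩
        q + suc d ∎))
        where open ≤-Reasoning

  lexMatchings-widen : ∀ d k e → e ≤ suc d * suc (suc d) → lexMatchings (suc d) k e ≤ lexMatchings d k e
  lexMatchings-widen d zero e _ = ≤-refl
  lexMatchings-widen d (suc zero) e _ = ≤-reflexive (trans (lexMatchings-1 (suc d) e) (sym (lexMatchings-1 d e)))
  lexMatchings-widen d (suc (suc i)) e e≤ =
    lexMatchings-widen-digits d i e (e / suc d) (e % suc d) (m%n<n e (suc d)) (m≡m%n+[m/n]*n e (suc d)) e≤

  lexMatchings-antitone : ∀ d d' k e → d ≤ d' → e ≤ suc d * suc d → lexMatchings d' k e ≤ lexMatchings d k e
  lexMatchings-antitone d d' k e d≤d' e≤ with m≤n⇒∃[o]m+o≡n d≤d'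
  ... | t , refl = go t
    where
    go : ∀ t → lexMatchings (d + t) k e ≤ lexMatchings d k e
    go zero rewrite +-identityʳ d = ≤-refl
    go (suc t) rewrite +-suc d t = ≤-trans (lexMatchings-widen (d + t) k e
      (≤-trans e≤ (*-mono-≤ (s≤s (m≤m+n d t)) (m≤n⇒m≤1+n (s≤s (m≤m+n d t)))))) (go t)

  lexCount-few-rows : ∀ D i Q C → Q < suc i → lexCount D (suc (suc i)) Q C ≡ 0
  lexCount-few-rows D i Q C Q<i
    rewrite choose-above {Q} {suc (suc i)} (m<n⇒m<1+n Q<i) | choose-above {Q} {suc i} Q<i = *-zeroʳ C

  -- Adding a row of M ≤ n+1 edges to a lex graph with e ≤ (n+1)M edges on n+1 right
  -- vertices, while also adding a right vertex, yields at most the (i+2)-matchings of the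
  -- original graph plus those using one of the M - (i+1) edges of the new row left free by
  -- an (i+1)-matching of the original. On digits e = c + q(n+1) with M = i+1+u, and
  -- q + C = c + M, the base-(n+2) digits of e + M are (q, C) or, after a carry, (q+1, C-n-2).
  extend-noCarry : ∀ n i u e q c C → e ≡ c + q * suc n → e ≤ suc n * (suc i + u) →
    q + C ≡ c + (suc i + u) → C < suc (suc n) →
    lexMatchings (suc n) (suc (suc i)) (e + (suc i + u))
      ≤ lexCount (suc n) (suc (suc i)) q c + u * lexCount (suc n) (suc i) q c
  extend-noCarry n i u e q c C e≡ e≤ q+C≡c+M C<n =
    subst (_≤ lexCount (suc n) (suc (suc i)) q c + u * lexCount (suc n) (suc i) q c)
      (sym (lexMatchings-digits (suc n) (suc (suc i)) (e + M) q C C<n (trans (cong (_+ M) e≡) (rebase c q n M C q+C≡c+M))))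
      (lexCount-extend n i q c u C q+C≡c+M (room n M e q c e≡ e≤))
    where
    M = suc i + u
    rebase : ∀ c q n M C → q + C ≡ c + M → c + q * suc n + M ≡ C + q * suc (suc n)
    rebase c q n M C h = trans (regroup₁ c q n M) (trans (cong (_+ q * suc n) (sym h)) (regroup₂ q C n))
      where
      regroup₁ : ∀ c q n M → c + q * suc n + M ≡ (c + M) + q * suc n
      regroup₁ = solve-∀
      regroup₂ : ∀ q C n → (q + C) + q * suc n ≡ C + q * suc (suc n)
      regroup₂ = solve-∀

  -- The carry case, C ≥ n+2 written as n+2+C.
  extend-carry : ∀ n i u e q c C → c < suc n → e ≡ c + q * suc n → suc i + u ≤ suc n →
    q + (suc (suc n) + C) ≡ c + (suc i + u) →
    lexMatchings (suc n) (suc (suc i)) (e + (suc i + u))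
      ≤ lexCount (suc n) (suc (suc i)) q c + u * lexCount (suc n) (suc i) q c
  extend-carry n i u e q c C c<n e≡ M≤n q+C≡c+M
    with m≤n⇒∃[o]m+o≡n (≤-trans M≤n (≤-trans (m≤m+n (suc n) q) (m≤m+n _ 1))) | m≤n⇒∃[o]m+o≡n (<⇒≤ c<n)
  ... | w , M+w≡ | s , c+s≡n =
    subst (_≤ lexCount (suc n) (suc (suc i)) q c + u * lexCount (suc n) (suc i) q c)
      (sym (lexMatchings-digits (suc n) (suc (suc i)) (e + M) (suc q) C C<n
        (trans (cong (_+ M) e≡) (rebase c q n M C carried))))
      (lexCount-extend-carry n i q c u s w C carried M+w≡ c+s≡n)
    where
    open ≤-Reasoning
    M = suc i + u
    regroup : ∀ C q n → q + (suc (suc n) + C) ≡ C + q + suc n + 1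
    regroup = solve-∀
    carried : C + q + suc n + 1 ≡ c + M
    carried = trans (sym (regroup C q n)) q+C≡c+M
    rebase : ∀ c q n M C → C + q + suc n + 1 ≡ c + M → c + q * suc n + M ≡ C + suc q * suc (suc n)
    rebase c q n M C h = trans (regroup₁ c q n M) (trans (cong (_+ q * suc n) (sym h)) (regroup₂ c q n C))
      where
      regroup₁ : ∀ c q n M → c + q * suc n + M ≡ (c + M) + q * suc n
      regroup₁ = solve-∀
      regroup₂ : ∀ c q n C → (C + q + suc n + 1) + q * suc n ≡ C + suc q * suc (suc n)
      regroup₂ = solve-∀
    C<n : C < suc (suc n)
    C<n = s≤s (+-cancelʳ-≤ (suc (suc n)) C (suc n) (begin
      C + suc (suc n)     ≤⟨ +-monoʳ-≤ C (m≤n+m (suc (suc n)) q) ⟩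
      C + (q + suc (suc n)) ≡⟨ trans (+-comm C _) (trans (+-assoc q _ C) (regroup C q n)) ⟩
      C + q + suc n + 1   ≡⟨ carried ⟩
      c + M               ≤⟨ +-mono-≤ (<⇒≤ c<n) M≤n ⟩
      suc n + suc n       ≤⟨ +-monoʳ-≤ (suc n) (n≤1+n _) ⟩
      suc n + suc (suc n) ∎))

  -- The extension inequality on digits: no (i+2)-matchings at all when M ≤ i (too few
  -- rows), otherwise M = i+1+u and the digits of e + M are found with or without a carry.
  lexMatchings-extend-digits : ∀ n i M e q c → c < suc n → e ≡ c + q * suc n → M ≤ suc n → e ≤ suc n * M →
    lexMatchings (suc n) (suc (suc i)) (e + M)
      ≤ lexCount (suc n) (suc (suc i)) q c + (M ∸ suc i) * lexCount (suc n) (suc i) q c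
  lexMatchings-extend-digits n i M e q c c<n e≡ M≤n e≤ with suc i ≤? M
  ... | no i≰M =
    ≤-trans (≤-reflexive (lexCount-few-rows (suc (suc n)) i Q ((e + M) % suc (suc n)) (≤-<-trans Q≤M (≰⇒> i≰M)))) z≤n
    where
    Q = (e + M) / suc (suc n)
    regroup : ∀ n M → suc n * M + M ≡ M * suc (suc n)
    regroup = solve-∀
    Q≤M : Q ≤ M
    Q≤M = quotient-bound (suc n) Q M (e + M) ((e + M) % suc (suc n)) (m≡m%n+[m/n]*n (e + M) (suc (suc n)))
            (≤-trans (+-monoˡ-≤ M e≤) (≤-reflexive (trans (regroup n M) (*-comm M (suc (suc n))))))
  ... | yes i≤M with m≤n⇒∃[o]m+o≡n i≤M
  ...   | u , refl rewrite m+n∸m≡n (suc i) u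
    with m≤n⇒∃[o]m+o≡n (≤-trans (quotient-bound n q M e c e≡ e≤) (m≤n+m M c))
  ...     | C , q+C≡c+M with C <? suc (suc n)
  ...       | yes C<n = extend-noCarry n i u e q c C e≡ e≤ q+C≡c+M C<n
  ...       | no C≮n with m≤n⇒∃[o]m+o≡n (≮⇒≥ C≮n)
  ...         | C' , refl = extend-carry n i u e q c C' c<n e≡ M≤n q+C≡c+M

  lexMatchings-extend : ∀ n M e j → M ≤ suc n → e ≤ suc n * M →
    lexMatchings (suc n) (suc j) (e + M) ≤ lexMatchings n (suc j) e + (M ∸ j) * lexMatchings n j e
  lexMatchings-extend n M e zero M≤n e≤ = ≤-reflexive (trans (lexMatchings-1 (suc n) (e + M))
    (cong₂ _+_ (sym (lexMatchings-1 n e)) (sym (*-identityʳ M))))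
  lexMatchings-extend n M e (suc i) M≤n e≤ = lexMatchings-extend-digits n i M e (e / suc n) (e % suc n)
    (m%n<n e (suc n)) (m≡m%n+[m/n]*n e (suc n)) M≤n e≤

-- Counting k-matchings row by row while avoiding a set of used right vertices.
module AvoidingMatchings where
  open import Data.Nat
  open import Data.Nat.Properties
  open import Data.Bool using (Bool; true; false; _∧_; _∨_; not)
  open import Data.Bool.Properties using (∧-comm; ∧-zeroʳ; ∨-zeroʳ; ∨-identityʳ)
  open import Data.Fin using (Fin; zero; suc)
  open import Data.Fin.Properties using () renaming (_≟_ to _≟ᶠ_)
  open import Data.Fin.Subset using (Subset; ⁅_⁆; _∪_; _⊆_; ⊥)
  open import Data.Fin.Subset.Properties using (∪-assoc; ∪-comm; ∪-idem; x∈p∪q⁺; x∈p∪q⁻; q⊆p∪q)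
  open import Data.Vec using (Vec; []; _∷_; lookup; removeAt)
  open import Data.Vec.Properties using (lookup-zipWith; lookup-replicate; []=⇒lookup; lookup⇒[]=)
  open import Data.Sum using (inj₁; inj₂; [_,_])
  open import Function using (_∘_)
  open import Relation.Nullary using (does; yes; no)
  open import Relation.Nullary.Decidable using (dec-true; dec-false)
  open import Relation.Binary.PropositionalEquality using (_≡_; refl; sym; trans; cong; cong₂; module ≡-Reasoning)
  open import Data.Nat.Tactic.RingSolver using (solve-∀)

  open Sums

  lookup-⁅⁆ : ∀ {n} (j i : Fin n) → lookup ⁅ j ⁆ i ≡ does (i ≟ᶠ j)
  lookup-⁅⁆ zero zero = refl
  lookup-⁅⁆ zero (suc i) = lookup-replicate i false
  lookup-⁅⁆ (suc j) zero = refl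
  lookup-⁅⁆ (suc j) (suc i) = lookup-⁅⁆ j i

  does-≟-sym : ∀ {n} (i j : Fin n) → does (i ≟ᶠ j) ≡ does (j ≟ᶠ i)
  does-≟-sym i j with i ≟ᶠ j
  ... | yes refl = sym (dec-true (i ≟ᶠ i) refl)
  ... | no i≢j = sym (dec-false (j ≟ᶠ i) (i≢j ∘ sym))

  -- Availability of j for a and then of i ≠ j for b is symmetric; e is "i = j".
  both-available : ∀ x y z w e → (x ∧ not y) ∧ (z ∧ not (e ∨ w)) ≡ (z ∧ not w) ∧ (x ∧ not (e ∨ y))
  both-available x y z w false = ∧-comm (x ∧ not y) (z ∧ not w)
  both-available x y z w true = begin
    (x ∧ not y) ∧ (z ∧ false) ≡⟨ cong ((x ∧ not y) ∧_) (∧-zeroʳ z) ⟩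
    (x ∧ not y) ∧ false       ≡⟨ ∧-zeroʳ _ ⟩
    false                     ≡⟨ ∧-zeroʳ _ ⟨
    (z ∧ not w) ∧ false       ≡⟨ cong ((z ∧ not w) ∧_) (∧-zeroʳ x) ⟨
    (z ∧ not w) ∧ (x ∧ false) ∎
    where open ≡-Reasoning

  module _ {r : ℕ} where

    lookup-insert : ∀ (U : Subset r) j i → lookup (⁅ j ⁆ ∪ U) i ≡ does (i ≟ᶠ j) ∨ lookup U i
    lookup-insert U j i = trans (lookup-zipWith _∨_ i ⁅ j ⁆ U) (cong (_∨ lookup U i) (lookup-⁅⁆ j i))

    insert-comm : ∀ (U : Subset r) i j → ⁅ i ⁆ ∪ (⁅ j ⁆ ∪ U) ≡ ⁅ j ⁆ ∪ (⁅ i ⁆ ∪ U)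
    insert-comm U i j = begin
      ⁅ i ⁆ ∪ (⁅ j ⁆ ∪ U) ≡⟨ ∪-assoc ⁅ i ⁆ ⁅ j ⁆ U ⟨
      (⁅ i ⁆ ∪ ⁅ j ⁆) ∪ U ≡⟨ cong (_∪ U) (∪-comm ⁅ i ⁆ ⁅ j ⁆) ⟩
      (⁅ j ⁆ ∪ ⁅ i ⁆) ∪ U ≡⟨ ∪-assoc ⁅ j ⁆ ⁅ i ⁆ U ⟩
      ⁅ j ⁆ ∪ (⁅ i ⁆ ∪ U) ∎
      where open ≡-Reasoning

    insert-idem : ∀ (U : Subset r) i → ⁅ i ⁆ ∪ (⁅ i ⁆ ∪ U) ≡ ⁅ i ⁆ ∪ U
    insert-idem U i = trans (sym (∪-assoc ⁅ i ⁆ ⁅ i ⁆ U)) (cong (_∪ U) (∪-idem ⁅ i ⁆))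

    available : Subset r → Subset r → Fin r → Bool
    available row U j = lookup row j ∧ not (lookup U j)

    available-insert : ∀ row U j i → available row (⁅ j ⁆ ∪ U) i ≡ lookup row i ∧ not (does (i ≟ᶠ j) ∨ lookup U i)
    available-insert row U j i = cong (λ b → lookup row i ∧ not b) (lookup-insert U j i)

    -- avoiding k U G: the number of k-matchings of the bipartite graph with rows G that use
    -- no right vertex of U, computed by deciding row after row whether the left vertex is
    -- matched, and if so to which available right vertex.
    avoiding : ∀ {ℓ} → ℕ → Subset r → Vec (Subset r) ℓ → ℕ

    -- The (k+1)-matchings of row ∷ G avoiding U that use the new row.
    oneRow : ∀ {ℓ} k (U row : Subset r) (G : Vec (Subset r) ℓ) → ℕ

    avoiding zero U G = 1
    avoiding (suc k) U [] = 0
    avoiding (suc k) U (row ∷ G) = avoiding (suc k) U G + oneRow k U row G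

    oneRow k U row G = ∑[ j < r ] ([ available row U j ]· avoiding k (⁅ j ⁆ ∪ U) G)

    -- Fixing the right vertex i matched to the first row, insertions of further vertices j
    -- before or after i give the same terms: the j = i term supplies the missing
    -- "i inserted first" term, and for j ≠ i the two insertions commute.
    insert-exchange : ∀ {ℓ} k (row U : Subset r) (G : Vec (Subset r) ℓ) (i : Fin r) →
      sum (λ j → [ available row (⁅ j ⁆ ∪ U) i ]· avoiding k (⁅ i ⁆ ∪ (⁅ j ⁆ ∪ U)) G)
        + [ available row U i ]· avoiding k (⁅ i ⁆ ∪ U) G
      ≡ [ available row U i ]· sum (λ j → avoiding k (⁅ j ⁆ ∪ (⁅ i ⁆ ∪ U)) G)
    insert-exchange k row U G i with lookup row i | lookup U i in Ui
    ... | false | _ = trans (+-identityʳ _) (sum-zero {r} (λ _ → refl))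
    ... | true | true = trans (+-identityʳ _) (sum-zero {r} (λ j →
            cong (λ b → [ not b ]· avoiding k (⁅ i ⁆ ∪ (⁅ j ⁆ ∪ U)) G)
              (trans (lookup-insert U j i) (trans (cong (does (i ≟ᶠ j) ∨_) Ui) (∨-zeroʳ _)))))
    ... | true | false = begin
      sum after + N₁                                   ≡⟨ cong (sum after +_) (sum-δ i N₁) ⟨
      sum after + sum (λ j → [ does (i ≟ᶠ j) ]· N₁)    ≡⟨ ∑-distrib-+ {r} _ _ ⟨
      sum (λ j → after j + [ does (i ≟ᶠ j) ]· N₁)      ≡⟨ sum-cong-≗ {r} termwise ⟩
      sum (λ j → avoiding k (⁅ j ⁆ ∪ (⁅ i ⁆ ∪ U)) G) ∎
      where
      open ≡-Reasoning
      N₁ = avoiding k (⁅ i ⁆ ∪ U) G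
      after : Fin r → ℕ
      after j = [ not (lookup (⁅ j ⁆ ∪ U) i) ]· avoiding k (⁅ i ⁆ ∪ (⁅ j ⁆ ∪ U)) G
      termwise : ∀ j → [ not (lookup (⁅ j ⁆ ∪ U) i) ]· avoiding k (⁅ i ⁆ ∪ (⁅ j ⁆ ∪ U)) G + [ does (i ≟ᶠ j) ]· N₁
                       ≡ avoiding k (⁅ j ⁆ ∪ (⁅ i ⁆ ∪ U)) G
      termwise j rewrite lookup-insert U j i | Ui | ∨-identityʳ (does (i ≟ᶠ j)) with i ≟ᶠ j
      ... | yes refl rewrite insert-idem U i = refl
      ... | no _ rewrite insert-comm U i j = +-identityʳ _

    -- Column counting: a k-matching avoiding U leaves r - k right vertices unused, so
    -- Σⱼ avoiding k (U ∪ {j}) = (r - k) · avoiding k U.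
    avoiding-columns : ∀ {ℓ} k (U : Subset r) (G : Vec (Subset r) ℓ) →
      sum (λ j → avoiding k (⁅ j ⁆ ∪ U) G) + k * avoiding k U G ≡ r * avoiding k U G
    avoiding-columns-step : ∀ {ℓ} k (row U : Subset r) (G : Vec (Subset r) ℓ) →
      sum (λ j → oneRow k (⁅ j ⁆ ∪ U) row G) + oneRow k U row G + k * oneRow k U row G ≡ r * oneRow k U row G

    avoiding-columns zero U G = trans (+-identityʳ _) (sum-const {r} 1)
    avoiding-columns (suc k) U [] =
      trans (cong₂ _+_ (sum-zero {r} (λ _ → refl)) (*-zeroʳ (suc k))) (sym (*-zeroʳ r))
    avoiding-columns (suc k) U (row ∷ G) = begin
      sum (λ j → A (⁅ j ⁆ ∪ U) + S (⁅ j ⁆ ∪ U)) + suc k * (A U + S U)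
        ≡⟨ cong (_+ suc k * (A U + S U)) (∑-distrib-+ {r} _ _) ⟩
      (sum (λ j → A (⁅ j ⁆ ∪ U)) + sum (λ j → S (⁅ j ⁆ ∪ U))) + suc k * (A U + S U)
        ≡⟨ regroup (sum (λ j → A (⁅ j ⁆ ∪ U))) (sum (λ j → S (⁅ j ⁆ ∪ U))) (A U) (S U) k ⟩
      (sum (λ j → A (⁅ j ⁆ ∪ U)) + suc k * A U) + (sum (λ j → S (⁅ j ⁆ ∪ U)) + S U + k * S U)
        ≡⟨ cong₂ _+_ (avoiding-columns (suc k) U G) (avoiding-columns-step k row U G) ⟩
      r * A U + r * S U
        ≡⟨ *-distribˡ-+ r _ _ ⟨
      r * (A U + S U) ∎
      where
      open ≡-Reasoning
      A : Subset r → ℕ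
      A V = avoiding (suc k) V G
      S : Subset r → ℕ
      S V = oneRow k V row G
      regroup : ∀ a b n s k → (a + b) + suc k * (n + s) ≡ (a + suc k * n) + (b + s + k * s)
      regroup = solve-∀

    avoiding-columns-step k row U G = begin
      sum (λ j → S (⁅ j ⁆ ∪ U)) + S U + k * S U
        ≡⟨ cong (λ x → x + S U + k * S U) (∑-comm {r} {r} (λ j i → term (⁅ j ⁆ ∪ U) i)) ⟩
      sum (λ i → sum (λ j → term (⁅ j ⁆ ∪ U) i)) + S U + k * S U
        ≡⟨ cong (_+ k * S U) (∑-distrib-+ {r} _ _) ⟨
      sum (λ i → sum (λ j → term (⁅ j ⁆ ∪ U) i) + term U i) + k * S U
        ≡⟨ cong₂ _+_ (sum-cong-≗ {r} (insert-exchange k row U G)) (*-distribˡ-sum {r} k _) ⟩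
      sum (λ i → [ a i ]· sum (λ j → avoiding k (⁅ j ⁆ ∪ (⁅ i ⁆ ∪ U)) G)) + sum (λ i → k * term U i)
        ≡⟨ ∑-distrib-+ {r} _ _ ⟨
      sum (λ i → [ a i ]· sum (λ j → avoiding k (⁅ j ⁆ ∪ (⁅ i ⁆ ∪ U)) G) + k * term U i)
        ≡⟨ sum-cong-≗ {r} termwise ⟩
      sum (λ i → r * term U i)
        ≡⟨ *-distribˡ-sum {r} r _ ⟨
      r * S U ∎
      where
      open ≡-Reasoning
      a : Fin r → Bool
      a i = available row U i
      term : Subset r → Fin r → ℕ
      term V i = [ available row V i ]· avoiding k (⁅ i ⁆ ∪ V) G
      S : Subset r → ℕ
      S V = oneRow k V row G
      termwise : ∀ i → [ a i ]· sum (λ j → avoiding k (⁅ j ⁆ ∪ (⁅ i ⁆ ∪ U)) G) + k * term U i ≡ r * term U i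
      termwise i = begin
        [ a i ]· X + k * [ a i ]· Y    ≡⟨ cong ([ a i ]· X +_) ([]·-comm-* (a i) k Y) ⟨
        [ a i ]· X + [ a i ]· (k * Y)  ≡⟨ []·-distrib-+ (a i) X (k * Y) ⟨
        [ a i ]· (X + k * Y)          ≡⟨ cong ([ a i ]·_) (avoiding-columns k (⁅ i ⁆ ∪ U) G) ⟩
        [ a i ]· (r * Y)              ≡⟨ []·-comm-* (a i) r Y ⟩
        r * [ a i ]· Y                ∎
        where
        X = sum (λ j → avoiding k (⁅ j ⁆ ∪ (⁅ i ⁆ ∪ U)) G)
        Y = avoiding k (⁅ i ⁆ ∪ U) G

    insert-mono : ∀ {U V : Subset r} j → U ⊆ V → ⁅ j ⁆ ∪ U ⊆ ⁅ j ⁆ ∪ V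
    insert-mono {U} j U⊆V x∈ = [ x∈p∪q⁺ ∘ inj₁ , x∈p∪q⁺ ∘ inj₂ ∘ U⊆V ] (x∈p∪q⁻ ⁅ j ⁆ U x∈)

    available-anti : ∀ {U V : Subset r} row j → U ⊆ V → available row V j ≡ true → available row U j ≡ true
    available-anti {U} {V} row j U⊆V avV with lookup row j | lookup U j in Uj | lookup V j in Vj
    ... | true | false | _ = refl
    ... | true | true | false with () ← trans (sym ([]=⇒lookup (U⊆V (lookup⇒[]= j U Uj)))) Vj
    available-anti row j U⊆V () | true | true | true
    available-anti row j U⊆V () | false | _ | _

    avoiding-anti : ∀ {ℓ} k {U V : Subset r} (G : Vec (Subset r) ℓ) → U ⊆ V → avoiding k V G ≤ avoiding k U G
    avoiding-anti zero G U⊆V = ≤-refl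
    avoiding-anti (suc k) [] U⊆V = ≤-refl
    avoiding-anti (suc k) (row ∷ G) U⊆V = +-mono-≤ (avoiding-anti (suc k) G U⊆V)
      (sum-mono (λ j → []·-mono (available-anti row j U⊆V) (avoiding-anti k G (insert-mono j U⊆V))))

    degree : Subset r → Subset r → ℕ
    degree row U = sum (λ j → [ available row U j ]· 1)

    -- Greedy lower bound for adding a row: every k-matching of G avoiding U leaves at
    -- least degree - k available vertices for the new row.
    avoiding-addRow : ∀ {ℓ} k (U row : Subset r) (G : Vec (Subset r) ℓ) →
      avoiding (suc k) U G + (degree row U ∸ k) * avoiding k U G ≤ avoiding (suc k) U (row ∷ G)
    avoiding-addRow k U row G = +-monoʳ-≤ (avoiding (suc k) U G) (begin
      (degree row U ∸ k) * N    ≡⟨ *-distribʳ-∸ N (degree row U) k ⟩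
      degree row U * N ∸ k * N  ≡⟨ cong (_∸ k * N) used≡ ⟨
      used ∸ k * N              ≤⟨ m≤n+o⇒m∸n≤o used (k * N) (+-cancelˡ-≤ unused used (k * N + S) count) ⟩
      S ∎)
      where
      open ≤-Reasoning
      a : Fin r → Bool
      a j = available row U j
      N = avoiding k U G
      Nⱼ : Fin r → ℕ
      Nⱼ j = avoiding k (⁅ j ⁆ ∪ U) G
      S = oneRow k U row G
      S̄ = sum (λ j → [ not (a j) ]· Nⱼ j)
      unused = sum (λ j → [ not (a j) ]· N)
      used = sum (λ j → [ a j ]· N)
      used≡ : used ≡ degree row U * N
      used≡ = trans (sum-cong-≗ {r} (λ j → []·-as-* (a j) N))
                (trans (sym (*-distribˡ-sum {r} N _)) (*-comm N _))
      regroup : ∀ s z x → s + z + x ≡ z + (x + s)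
      regroup = solve-∀
      -- Σⱼ Nⱼ = (r - k) N splits into the available vertices (S) and the unavailable ones,
      -- each of which contributes at most N.
      count : unused + used ≤ unused + (k * N + S)
      count = begin
        unused + used        ≡⟨ ∑-distrib-+ {r} _ _ ⟨
        sum (λ j → [ not (a j) ]· N + [ a j ]· N)
          ≡⟨ trans (sum-cong-≗ {r} (λ j → trans (+-comm ([ not (a j) ]· N) ([ a j ]· N)) ([]·-split (a j) N))) (sum-const {r} N) ⟩
        r * N                ≡⟨ avoiding-columns k U G ⟨
        sum Nⱼ + k * N       ≡⟨ cong (_+ k * N) (trans (sum-cong-≗ {r} (λ j → sym ([]·-split (a j) (Nⱼ j)))) (∑-distrib-+ {r} _ _)) ⟩
        S + S̄ + k * N       ≤⟨ +-monoˡ-≤ (k * N) (+-monoʳ-≤ S (sum-mono (λ j → []·-mono (λ h → h)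
                                    (avoiding-anti k G (q⊆p∪q ⁅ j ⁆ U))))) ⟩
        S + unused + k * N   ≡⟨ regroup S unused (k * N) ⟩
        unused + (k * N + S) ∎

    -- Matchings that use both of two new rows, a matched to j and then b matched to i.
    bothRows : ∀ {ℓ} k (U a b : Subset r) (G : Vec (Subset r) ℓ) → ℕ
    bothRows k U a b G = sum (λ j → sum (λ i →
      [ available a U j ∧ available b (⁅ j ⁆ ∪ U) i ]· avoiding k (⁅ i ⁆ ∪ (⁅ j ⁆ ∪ U)) G))

    bothRows-sym : ∀ {ℓ} k (U a b : Subset r) (G : Vec (Subset r) ℓ) → bothRows k U a b G ≡ bothRows k U b a G
    bothRows-sym k U a b G =
      trans (∑-comm {r} {r} _) (sum-cong-≗ {r} (λ i → sum-cong-≗ {r} (λ j → same-pair i j)))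
      where
      same-pair : ∀ i j →
        [ available a U j ∧ available b (⁅ j ⁆ ∪ U) i ]· avoiding k (⁅ i ⁆ ∪ (⁅ j ⁆ ∪ U)) G
          ≡ [ available b U i ∧ available a (⁅ i ⁆ ∪ U) j ]· avoiding k (⁅ j ⁆ ∪ (⁅ i ⁆ ∪ U)) G
      same-pair i j rewrite insert-comm U i j | available-insert b U j i | available-insert a U i j
                          | does-≟-sym j i =
        cong (λ c → [ c ]· avoiding k (⁅ j ⁆ ∪ (⁅ i ⁆ ∪ U)) G)
          (both-available (lookup a j) (lookup U j) (lookup b i) (lookup U i) (does (i ≟ᶠ j)))

    twoRows : ∀ {ℓ} k (U a b : Subset r) (G : Vec (Subset r) ℓ) →
      avoiding (suc (suc k)) U (a ∷ b ∷ G)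
        ≡ avoiding (suc (suc k)) U G + oneRow (suc k) U b G + (oneRow (suc k) U a G + bothRows k U a b G)
    twoRows k U a b G = cong (avoiding (suc (suc k)) U G + oneRow (suc k) U b G +_) (begin
      sum (λ j → [ available a U j ]· (avoiding (suc k) (⁅ j ⁆ ∪ U) G + B j))
        ≡⟨ sum-cong-≗ {r} (λ j → []·-distrib-+ (available a U j) _ _) ⟩
      sum (λ j → [ available a U j ]· avoiding (suc k) (⁅ j ⁆ ∪ U) G + [ available a U j ]· B j)
        ≡⟨ ∑-distrib-+ {r} _ _ ⟩
      oneRow (suc k) U a G + sum (λ j → [ available a U j ]· B j)
        ≡⟨ cong (oneRow (suc k) U a G +_) (sum-cong-≗ {r} λ j →
             trans ([]·-sum {r} (available a U j) _) (sum-cong-≗ {r} (λ i → []·-∧ (available a U j) _ _))) ⟩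
      oneRow (suc k) U a G + bothRows k U a b G ∎)
      where
      open ≡-Reasoning
      B : Fin r → ℕ
      B j = sum (λ i → [ available b (⁅ j ⁆ ∪ U) i ]· avoiding k (⁅ i ⁆ ∪ (⁅ j ⁆ ∪ U)) G)

    avoiding-swap : ∀ {ℓ} k (U a b : Subset r) (G : Vec (Subset r) ℓ) →
      avoiding k U (a ∷ b ∷ G) ≡ avoiding k U (b ∷ a ∷ G)
    avoiding-swap zero U a b G = refl
    avoiding-swap (suc zero) U a b G = +-assoc-comm (avoiding 1 U G) (sum (λ j → [ available b U j ]· 1))
                                                     (sum (λ j → [ available a U j ]· 1))
      where
      +-assoc-comm : ∀ n x y → n + x + y ≡ n + y + x
      +-assoc-comm = solve-∀
    avoiding-swap (suc (suc k)) U a b G = begin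
      avoiding (suc (suc k)) U (a ∷ b ∷ G) ≡⟨ twoRows k U a b G ⟩
      N + B + (A + bothRows k U a b G)     ≡⟨ cong (λ x → N + B + (A + x)) (bothRows-sym k U a b G) ⟩
      N + B + (A + bothRows k U b a G)     ≡⟨ regroup N B A _ ⟩
      N + A + (B + bothRows k U b a G)     ≡⟨ twoRows k U b a G ⟨
      avoiding (suc (suc k)) U (b ∷ a ∷ G) ∎
      where
      open ≡-Reasoning
      N = avoiding (suc (suc k)) U G
      A = oneRow (suc k) U a G
      B = oneRow (suc k) U b G
      regroup : ∀ n b a d → n + b + (a + d) ≡ n + a + (b + d)
      regroup = solve-∀

  _≈ᵐ_ : ∀ {r ℓ ℓ'} → Vec (Subset r) ℓ → Vec (Subset r) ℓ' → Set
  G ≈ᵐ H = ∀ k U → avoiding k U G ≡ avoiding k U H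

  ≈ᵐ-trans : ∀ {r ℓ₁ ℓ₂ ℓ₃} {G : Vec (Subset r) ℓ₁} {H : Vec (Subset r) ℓ₂} {K : Vec (Subset r) ℓ₃} →
    G ≈ᵐ H → H ≈ᵐ K → G ≈ᵐ K
  ≈ᵐ-trans G≈H H≈K k U = trans (G≈H k U) (H≈K k U)

  ≈ᵐ-cons : ∀ {r ℓ ℓ'} (row : Subset r) {G : Vec (Subset r) ℓ} {H : Vec (Subset r) ℓ'} →
    G ≈ᵐ H → (row ∷ G) ≈ᵐ (row ∷ H)
  ≈ᵐ-cons row G≈H zero U = refl
  ≈ᵐ-cons row G≈H (suc k) U =
    cong₂ _+_ (G≈H (suc k) U) (sum-cong-≗ (λ j → cong ([ available row U j ]·_) (G≈H k (⁅ j ⁆ ∪ U))))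

  ≈ᵐ-emptyRow : ∀ {r ℓ} (G : Vec (Subset r) ℓ) → (⊥ ∷ G) ≈ᵐ G
  ≈ᵐ-emptyRow G zero U = refl
  ≈ᵐ-emptyRow {r} G (suc k) U = trans (cong (avoiding (suc k) U G +_)
    (sum-zero {r} (λ j → cong (λ b → [ b ∧ not (lookup U j) ]· avoiding k (⁅ j ⁆ ∪ U) G) (lookup-replicate j false))))
    (+-identityʳ _)

  ≈ᵐ-reflexive : ∀ {r ℓ} {G H : Vec (Subset r) ℓ} → G ≡ H → G ≈ᵐ H
  ≈ᵐ-reflexive refl k U = refl

  ≈ᵐ-removeAt : ∀ {r n} (G : Vec (Subset r) (suc n)) i → G ≈ᵐ (lookup G i ∷ removeAt G i)
  ≈ᵐ-removeAt (row ∷ G) zero k U = refl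
  ≈ᵐ-removeAt (row ∷ G@(_ ∷ _)) (suc i) =
    ≈ᵐ-trans (≈ᵐ-cons row (≈ᵐ-removeAt G i)) (λ k U → avoiding-swap k U row (lookup G i) (removeAt G i))

-- The count m_k of the statement, by enumeration of 0/1 matrices, agrees with the row-by-row count.
module Enumeration where
  open import Data.Nat using (ℕ; zero; suc; _+_; _<ᵇ_; _≡ᵇ_)
  open import Data.Nat.Properties using (+-identityʳ; +-assoc)
  open import Data.Bool using (Bool; true; false; _∧_; _∨_; not; if_then_else_)
  open import Data.Bool.Properties using (∧-zeroʳ; ∧-identityʳ; ∧-commutativeMonoid)
  open import Data.Fin using (Fin; zero; suc)
  open import Data.Fin.Subset using (Subset; ⁅_⁆; _∪_; ⊥)
  open import Data.Fin.Subset.Properties using (∪-identityˡ)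
  open import Data.Vec using (Vec; []; _∷_; lookup; zipWith)
  import Data.Vec as Vec
  open import Data.List using (List; []; _∷_; length; filterᵇ; concatMap; _++_)
  import Data.List as List
  open import Relation.Binary.PropositionalEquality using (_≡_; refl; sym; trans; cong; cong₂; module ≡-Reasoning)
  open import Algebra.Solver.CommutativeMonoid ∧-commutativeMonoid using (solve; _⊕_; _⊜_)
  open import Data.Nat.Tactic.RingSolver using (solve-∀)

  open Sums
  open AvoidingMatchings

  ∑ˡ : ∀ {A : Set} → (A → ℕ) → List A → ℕ
  ∑ˡ f [] = 0
  ∑ˡ f (x ∷ xs) = f x + ∑ˡ f xs

  ∑ˡ-cong : ∀ {A : Set} {f g : A → ℕ} xs → (∀ x → f x ≡ g x) → ∑ˡ f xs ≡ ∑ˡ g xs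
  ∑ˡ-cong [] f≡g = refl
  ∑ˡ-cong (x ∷ xs) f≡g = cong₂ _+_ (f≡g x) (∑ˡ-cong xs f≡g)

  ∑ˡ-zero : ∀ {A : Set} {f : A → ℕ} xs → (∀ x → f x ≡ 0) → ∑ˡ f xs ≡ 0
  ∑ˡ-zero [] f≡0 = refl
  ∑ˡ-zero (x ∷ xs) f≡0 = cong₂ _+_ (f≡0 x) (∑ˡ-zero xs f≡0)

  ∑ˡ-distrib-+ : ∀ {A : Set} (f g : A → ℕ) xs → ∑ˡ (λ x → f x + g x) xs ≡ ∑ˡ f xs + ∑ˡ g xs
  ∑ˡ-distrib-+ f g [] = refl
  ∑ˡ-distrib-+ f g (x ∷ xs) = trans (cong (f x + g x +_) (∑ˡ-distrib-+ f g xs)) (interchange (f x) (g x) _ _)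
    where
    interchange : ∀ a b c d → a + b + (c + d) ≡ a + c + (b + d)
    interchange = solve-∀

  ∑ˡ-comm : ∀ {A B : Set} (f : A → B → ℕ) xs ys →
    ∑ˡ (λ x → ∑ˡ (f x) ys) xs ≡ ∑ˡ (λ y → ∑ˡ (λ x → f x y) xs) ys
  ∑ˡ-comm f [] ys = sym (∑ˡ-zero ys (λ _ → refl))
  ∑ˡ-comm f (x ∷ xs) ys = trans (cong (∑ˡ (f x) ys +_) (∑ˡ-comm f xs ys))
    (sym (∑ˡ-distrib-+ (f x) (λ y → ∑ˡ (λ x → f x y) xs) ys))

  ∑ˡ-++ : ∀ {A : Set} (f : A → ℕ) xs ys → ∑ˡ f (xs ++ ys) ≡ ∑ˡ f xs + ∑ˡ f ys
  ∑ˡ-++ f [] ys = refl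
  ∑ˡ-++ f (x ∷ xs) ys = trans (cong (f x +_) (∑ˡ-++ f xs ys)) (sym (+-assoc (f x) _ _))

  ∑ˡ-concatMap : ∀ {A B : Set} (f : B → ℕ) (g : A → List B) xs → ∑ˡ f (concatMap g xs) ≡ ∑ˡ (λ x → ∑ˡ f (g x)) xs
  ∑ˡ-concatMap f g [] = refl
  ∑ˡ-concatMap f g (x ∷ xs) = trans (∑ˡ-++ f (g x) (concatMap g xs)) (cong (∑ˡ f (g x) +_) (∑ˡ-concatMap f g xs))

  ∑ˡ-map : ∀ {A B : Set} (f : B → ℕ) (g : A → B) xs → ∑ˡ f (List.map g xs) ≡ ∑ˡ (λ x → f (g x)) xs
  ∑ˡ-map f g [] = refl
  ∑ˡ-map f g (x ∷ xs) = cong (f (g x) +_) (∑ˡ-map f g xs)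

  []·-∑ˡ : ∀ {A : Set} b (f : A → ℕ) xs → [ b ]· ∑ˡ f xs ≡ ∑ˡ (λ x → [ b ]· f x) xs
  []·-∑ˡ true f xs = refl
  []·-∑ˡ false f xs = sym (∑ˡ-zero xs (λ _ → refl))

  length-filterᵇ-filterᵇ : ∀ {A : Set} (p q : A → Bool) xs →
    length (filterᵇ p (filterᵇ q xs)) ≡ ∑ˡ (λ x → [ q x ∧ p x ]· 1) xs
  length-filterᵇ-filterᵇ p q [] = refl
  length-filterᵇ-filterᵇ p q (x ∷ xs) with q x
  ... | false = length-filterᵇ-filterᵇ p q xs
  ... | true with p x
  ...   | true = cong suc (length-filterᵇ-filterᵇ p q xs)
  ...   | false = length-filterᵇ-filterᵇ p q xs

  ∑-rows-empty : ∀ r (g : Vec Bool r → ℕ) → ∑ˡ (λ v → [ countTrue v <ᵇ 1 ]· g v) (allVecs r) ≡ g ⊥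
  ∑-rows-empty zero g = +-identityʳ _
  ∑-rows-empty (suc r) g = begin
    ∑ˡ (λ v → [ countTrue v <ᵇ 1 ]· g v) (allVecs (suc r))
      ≡⟨ ∑ˡ-concatMap _ (λ v → (false ∷ v) ∷ (true ∷ v) ∷ []) (allVecs r) ⟩
    ∑ˡ (λ v → [ countTrue v <ᵇ 1 ]· g (false ∷ v) + (0 + 0)) (allVecs r)
      ≡⟨ ∑ˡ-cong (allVecs r) (λ v → +-identityʳ _) ⟩
    ∑ˡ (λ v → [ countTrue v <ᵇ 1 ]· g (false ∷ v)) (allVecs r)
      ≡⟨ ∑-rows-empty r (λ v → g (false ∷ v)) ⟩
    g ⊥ ∎
    where open ≡-Reasoning

  ∑-rows-atMostOne : ∀ r (h : Vec Bool r → ℕ) →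
    ∑ˡ (λ v → [ atMostOne v ]· h v) (allVecs r) ≡ h ⊥ + sum (λ j → h ⁅ j ⁆)
  ∑-rows-atMostOne zero h = refl
  ∑-rows-atMostOne (suc r) h = begin
    ∑ˡ (λ v → [ atMostOne v ]· h v) (allVecs (suc r))
      ≡⟨ ∑ˡ-concatMap _ (λ v → (false ∷ v) ∷ (true ∷ v) ∷ []) (allVecs r) ⟩
    ∑ˡ (λ v → [ atMostOne v ]· h (false ∷ v) + ([ countTrue v <ᵇ 1 ]· h (true ∷ v) + 0)) (allVecs r)
      ≡⟨ ∑ˡ-cong (allVecs r) (λ v → cong ([ atMostOne v ]· h (false ∷ v) +_) (+-identityʳ _)) ⟩
    ∑ˡ (λ v → [ atMostOne v ]· h (false ∷ v) + [ countTrue v <ᵇ 1 ]· h (true ∷ v)) (allVecs r)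
      ≡⟨ ∑ˡ-distrib-+ _ _ (allVecs r) ⟩
    ∑ˡ (λ v → [ atMostOne v ]· h (false ∷ v)) (allVecs r) + ∑ˡ (λ v → [ countTrue v <ᵇ 1 ]· h (true ∷ v)) (allVecs r)
      ≡⟨ cong₂ _+_ (∑-rows-atMostOne r (λ v → h (false ∷ v))) (∑-rows-empty r (λ v → h (true ∷ v))) ⟩
    h (false ∷ ⊥) + sum (λ j → h (false ∷ ⁅ j ⁆)) + h (true ∷ ⊥)
      ≡⟨ regroup (h (false ∷ ⊥)) (sum (λ j → h (false ∷ ⁅ j ⁆))) (h (true ∷ ⊥)) ⟩
    h ⊥ + sum (λ j → h ⁅ j ⁆) ∎
    where
    open ≡-Reasoning
    regroup : ∀ a b c → a + b + c ≡ a + (c + b)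
    regroup = solve-∀

  -- Column conditions for a matching M avoiding a set U of right vertices: each column
  -- meets M at most once, and not at all when its right vertex lies in U.
  columnOK : ∀ {ℓ} → Vec Bool ℓ → Bool → Bool
  columnOK col u = if u then countTrue col <ᵇ 1 else atMostOne col

  columnsOK : ∀ {ℓ r} → BipGraph ℓ r → Subset r → Bool
  columnsOK M U = allB (zipWith columnOK (transpose M) U)

  disjoint : ∀ {r} → Vec Bool r → Subset r → Bool
  disjoint v U = allB (zipWith (λ a u → not (a ∧ u)) v U)

  columnOK-cons : ∀ {ℓ} a (col : Vec Bool ℓ) u → columnOK (a ∷ col) u ≡ not (a ∧ u) ∧ columnOK col (a ∨ u)
  columnOK-cons true col true = refl
  columnOK-cons true col false = refl
  columnOK-cons false col true = refl
  columnOK-cons false col false = refl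

  columnsOK-cons : ∀ {ℓ r} (v : Vec Bool r) (M : BipGraph ℓ r) U →
    columnsOK (v ∷ M) U ≡ disjoint v U ∧ columnsOK M (v ∪ U)
  columnsOK-cons v M U = go v (transpose M) U
    where
    interchange : ∀ x y d c → (x ∧ y) ∧ (d ∧ c) ≡ (x ∧ d) ∧ (y ∧ c)
    interchange = solve 4 (λ x y d c → (x ⊕ y) ⊕ (d ⊕ c) ⊜ (x ⊕ d) ⊕ (y ⊕ c)) refl
    go : ∀ {ℓ r} (v : Vec Bool r) (cols : Vec (Vec Bool ℓ) r) U →
      allB (zipWith columnOK (zipWith _∷_ v cols) U) ≡ disjoint v U ∧ allB (zipWith columnOK cols (v ∪ U))
    go [] [] [] = refl
    go (a ∷ v) (col ∷ cols) (u ∷ U) rewrite columnOK-cons a col u | go v cols U =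
      interchange (not (a ∧ u)) (columnOK col (a ∨ u)) (disjoint v U) (allB (zipWith columnOK cols (v ∪ U)))

  columnsOK-[] : ∀ {r} (U : Subset r) → columnsOK ([] {A = Vec Bool r}) U ≡ true
  columnsOK-[] [] = refl
  columnsOK-[] (true ∷ U) = columnsOK-[] U
  columnsOK-[] (false ∷ U) = columnsOK-[] U

  columnsOK-⊥ : ∀ {ℓ r} (M : BipGraph ℓ r) → columnsOK M ⊥ ≡ allB (Vec.map atMostOne (transpose M))
  columnsOK-⊥ M = go (transpose M)
    where
    go : ∀ {ℓ r} (cols : Vec (Vec Bool ℓ) r) → allB (zipWith columnOK cols ⊥) ≡ allB (Vec.map atMostOne cols)
    go [] = refl
    go (col ∷ cols) = cong (atMostOne col ∧_) (go cols)

  countTrue-⊥ : ∀ r → countTrue (⊥ {n = r}) ≡ 0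
  countTrue-⊥ zero = refl
  countTrue-⊥ (suc r) = countTrue-⊥ r

  countTrue-⁅⁆ : ∀ {r} (j : Fin r) → countTrue ⁅ j ⁆ ≡ 1
  countTrue-⁅⁆ {suc r} zero = cong suc (countTrue-⊥ r)
  countTrue-⁅⁆ (suc j) = countTrue-⁅⁆ j

  subrow : ∀ {r} → Vec Bool r → Vec Bool r → Bool
  subrow v row = allB (zipWith (λ a b → not a ∨ b) v row)

  subrow-⊥ : ∀ {r} (row : Vec Bool r) → subrow ⊥ row ≡ true
  subrow-⊥ [] = refl
  subrow-⊥ (b ∷ row) = subrow-⊥ row

  subrow-⁅⁆ : ∀ {r} (j : Fin r) (row : Vec Bool r) → subrow ⁅ j ⁆ row ≡ lookup row j
  subrow-⁅⁆ zero (b ∷ row) rewrite subrow-⊥ row = ∧-identityʳ b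
  subrow-⁅⁆ (suc j) (b ∷ row) = subrow-⁅⁆ j row

  disjoint-⊥ : ∀ {r} (U : Subset r) → disjoint ⊥ U ≡ true
  disjoint-⊥ [] = refl
  disjoint-⊥ (u ∷ U) = disjoint-⊥ U

  disjoint-⁅⁆ : ∀ {r} (j : Fin r) (U : Subset r) → disjoint ⁅ j ⁆ U ≡ not (lookup U j)
  disjoint-⁅⁆ zero (u ∷ U) rewrite disjoint-⊥ U = ∧-identityʳ (not u)
  disjoint-⁅⁆ (suc j) (u ∷ U) = disjoint-⁅⁆ j U

  isMatchingAvoiding : ∀ {ℓ r} → BipGraph ℓ r → BipGraph ℓ r → Subset r → ℕ → Bool
  isMatchingAvoiding M G U k = (subgraph M G ∧ allB (Vec.map atMostOne M) ∧ columnsOK M U) ∧ (edges M ≡ᵇ k)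

  enumAvoiding : ∀ {ℓ r} → ℕ → Subset r → BipGraph ℓ r → ℕ
  enumAvoiding {ℓ} {r} k U G = ∑ˡ (λ M → [ isMatchingAvoiding M G U k ]· 1) (allMatrices ℓ r)

  module _ {ℓ r : ℕ} (k : ℕ) (U row : Subset r) (G : BipGraph ℓ r) where

    withFirstRow : Vec Bool r → ℕ
    withFirstRow v = ∑ˡ (λ M → [ isMatchingAvoiding (v ∷ M) (row ∷ G) U k ]· 1) (allMatrices ℓ r)

    atMostOne-factor : ∀ v → withFirstRow v ≡ [ atMostOne v ]· withFirstRow v
    atMostOne-factor v =
      trans (∑ˡ-cong (allMatrices ℓ r) (λ M → trans (cong ([_]· 1) (factor (atMostOne v) (subrow v row ∧ subgraph M G)
              (allB (Vec.map atMostOne M)) (columnsOK (v ∷ M) U) (edges (v ∷ M) ≡ᵇ k)))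
            (sym ([]·-∧ (atMostOne v) (isMatchingAvoiding (v ∷ M) (row ∷ G) U k) 1))))
            (sym ([]·-∑ˡ (atMostOne v) _ (allMatrices ℓ r)))
      where
      factor : ∀ a x r c e → (x ∧ ((a ∧ r) ∧ c)) ∧ e ≡ a ∧ ((x ∧ ((a ∧ r) ∧ c)) ∧ e)
      factor true x r c e = refl
      factor false x r c e = cong (_∧ e) (∧-zeroʳ x)

    enumAvoiding-cons : enumAvoiding k U (row ∷ G) ≡ withFirstRow ⊥ + sum (λ j → withFirstRow ⁅ j ⁆)
    enumAvoiding-cons = begin
      enumAvoiding k U (row ∷ G)
        ≡⟨ ∑ˡ-concatMap _ (λ M → List.map (λ v → v ∷ M) (allVecs r)) (allMatrices ℓ r) ⟩
      ∑ˡ (λ M → ∑ˡ (λ M' → [ isMatchingAvoiding M' (row ∷ G) U k ]· 1) (List.map (λ v → v ∷ M) (allVecs r))) (allMatrices ℓ r)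
        ≡⟨ ∑ˡ-cong (allMatrices ℓ r) (λ M → ∑ˡ-map _ (λ v → v ∷ M) (allVecs r)) ⟩
      ∑ˡ (λ M → ∑ˡ (λ v → [ isMatchingAvoiding (v ∷ M) (row ∷ G) U k ]· 1) (allVecs r)) (allMatrices ℓ r)
        ≡⟨ ∑ˡ-comm (λ M v → [ isMatchingAvoiding (v ∷ M) (row ∷ G) U k ]· 1) (allMatrices ℓ r) (allVecs r) ⟩
      ∑ˡ withFirstRow (allVecs r)
        ≡⟨ ∑ˡ-cong (allVecs r) atMostOne-factor ⟩
      ∑ˡ (λ v → [ atMostOne v ]· withFirstRow v) (allVecs r)
        ≡⟨ ∑-rows-atMostOne r withFirstRow ⟩
      withFirstRow ⊥ + sum (λ j → withFirstRow ⁅ j ⁆) ∎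
      where open ≡-Reasoning

    withFirstRow-⊥ : withFirstRow ⊥ ≡ enumAvoiding k U G
    withFirstRow-⊥ = ∑ˡ-cong (allMatrices ℓ r) (λ M → cong ([_]· 1) (drop M))
      where
      drop : ∀ M → isMatchingAvoiding (⊥ ∷ M) (row ∷ G) U k ≡ isMatchingAvoiding M G U k
      drop M rewrite subrow-⊥ row | countTrue-⊥ r | columnsOK-cons ⊥ M U | disjoint-⊥ U | ∪-identityˡ U = refl

  withFirstRow-⁅⁆ : ∀ {ℓ r} k (U row : Subset r) (G : BipGraph ℓ r) j →
    withFirstRow (suc k) U row G ⁅ j ⁆ ≡ [ available row U j ]· enumAvoiding k (⁅ j ⁆ ∪ U) G
  withFirstRow-⁅⁆ {ℓ} {r} k U row G j =
    trans (∑ˡ-cong (allMatrices ℓ r) (λ M → trans (cong ([_]· 1) (use M)) (sym ([]·-∧ (available row U j) _ 1))))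
          (sym ([]·-∑ˡ (available row U j) _ (allMatrices ℓ r)))
    where
    regroup : ∀ a s r u c e → ((a ∧ s) ∧ (r ∧ (u ∧ c))) ∧ e ≡ (a ∧ u) ∧ ((s ∧ (r ∧ c)) ∧ e)
    regroup = solve 6 (λ a s r u c e → ((a ⊕ s) ⊕ (r ⊕ (u ⊕ c))) ⊕ e ⊜ (a ⊕ u) ⊕ ((s ⊕ (r ⊕ c)) ⊕ e)) refl
    use : ∀ M → isMatchingAvoiding (⁅ j ⁆ ∷ M) (row ∷ G) U (suc k)
                ≡ available row U j ∧ isMatchingAvoiding M G (⁅ j ⁆ ∪ U) k
    use M rewrite subrow-⁅⁆ j row | countTrue-⁅⁆ j | columnsOK-cons ⁅ j ⁆ M U | disjoint-⁅⁆ j U =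
      regroup (lookup row j) (subgraph M G) (allB (Vec.map atMostOne M)) (not (lookup U j))
              (columnsOK M (⁅ j ⁆ ∪ U)) (edges M ≡ᵇ k)

  withFirstRow-⁅⁆-0 : ∀ {ℓ r} (U row : Subset r) (G : BipGraph ℓ r) j → withFirstRow 0 U row G ⁅ j ⁆ ≡ 0
  withFirstRow-⁅⁆-0 {ℓ} {r} U row G j = ∑ˡ-zero (allMatrices ℓ r) (λ M → cong ([_]· 1) (one-edge M))
    where
    one-edge : ∀ M → isMatchingAvoiding (⁅ j ⁆ ∷ M) (row ∷ G) U 0 ≡ false
    one-edge M rewrite countTrue-⁅⁆ j = ∧-zeroʳ _

  -- The enumeration satisfies the row recursion of `avoiding`.
  enumAvoiding≡avoiding : ∀ {ℓ r} k (U : Subset r) (G : BipGraph ℓ r) → enumAvoiding k U G ≡ avoiding k U G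
  enumAvoiding≡avoiding zero U [] rewrite columnsOK-[] U = refl
  enumAvoiding≡avoiding (suc k) U [] rewrite columnsOK-[] U = refl
  enumAvoiding≡avoiding {r = r} zero U (row ∷ G) = begin
    enumAvoiding zero U (row ∷ G)                                    ≡⟨ enumAvoiding-cons zero U row G ⟩
    withFirstRow zero U row G ⊥ + sum (λ j → withFirstRow zero U row G ⁅ j ⁆)
      ≡⟨ cong₂ _+_ (trans (withFirstRow-⊥ zero U row G) (enumAvoiding≡avoiding zero U G))
                   (sum-zero {r} (withFirstRow-⁅⁆-0 U row G)) ⟩
    1 ∎
    where open ≡-Reasoning
  enumAvoiding≡avoiding {r = r} (suc k) U (row ∷ G) = begin
    enumAvoiding (suc k) U (row ∷ G)                                  ≡⟨ enumAvoiding-cons (suc k) U row G ⟩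
    withFirstRow (suc k) U row G ⊥ + sum (λ j → withFirstRow (suc k) U row G ⁅ j ⁆)
      ≡⟨ cong₂ _+_ (trans (withFirstRow-⊥ (suc k) U row G) (enumAvoiding≡avoiding (suc k) U G))
           (sum-cong-≗ {r} (λ j → trans (withFirstRow-⁅⁆ k U row G j)
             (cong ([ available row U j ]·_) (enumAvoiding≡avoiding k (⁅ j ⁆ ∪ U) G)))) ⟩
    avoiding (suc k) U (row ∷ G) ∎
    where open ≡-Reasoning

  mk≡avoiding : ∀ {ℓ r} k (G : BipGraph ℓ r) → mk k G ≡ avoiding k ⊥ G
  mk≡avoiding {ℓ} {r} k G = begin
    mk k G                ≡⟨ length-filterᵇ-filterᵇ (λ M → edges M ≡ᵇ k) (λ M → isMatching M G) (allMatrices ℓ r) ⟩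
    ∑ˡ (λ M → [ isMatching M G ∧ (edges M ≡ᵇ k) ]· 1) (allMatrices ℓ r)
      ≡⟨ ∑ˡ-cong (allMatrices ℓ r) (λ M → cong (λ c → [ (subgraph M G ∧ allB (Vec.map atMostOne M) ∧ c) ∧ (edges M ≡ᵇ k) ]· 1)
                                              (sym (columnsOK-⊥ M))) ⟩
    enumAvoiding k ⊥ G    ≡⟨ enumAvoiding≡avoiding k ⊥ G ⟩
    avoiding k ⊥ G        ∎
    where open ≡-Reasoning

-- Evaluating the row-by-row count on the lex graph of the statement.
module LexGraph where
  open import Data.Nat
  open import Data.Nat.Properties
  open import Data.Nat.DivMod using (_/_; _%_; m%n<n; m≡m%n+[m/n]*n)
  open import Data.Bool using (Bool; true; false; _∧_; _∨_; not)
  open import Data.Fin using (zero; suc; toℕ)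
  open import Data.Fin.Subset using (Subset; ⁅_⁆; _∪_; ⊥; ⊤)
  open import Data.Fin.Subset.Properties using (∪-identityˡ)
  open import Data.Vec using (Vec; []; _∷_; lookup; replicate; tabulate)
  open import Data.Vec.Properties using (lookup-replicate; lookup∘tabulate; tabulate-cong)
  open import Relation.Nullary using (yes; no; contradiction)
  open import Relation.Nullary.Decidable using (dec-true; dec-false)
  open import Relation.Binary.PropositionalEquality using (_≡_; refl; sym; trans; cong; cong₂; subst; module ≡-Reasoning)
  open import Data.Nat.Tactic.RingSolver using (solve-∀)

  open Sums
  open LexCounting
  open AvoidingMatchings

  free : ∀ {r} → Subset r → ℕ
  free U = sum (λ j → [ not (lookup U j) ]· 1)

  free-insert : ∀ {r} (U : Subset r) j → lookup U j ≡ false → suc (free (⁅ j ⁆ ∪ U)) ≡ free U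
  free-insert (u ∷ U) zero Uj rewrite Uj | ∪-identityˡ U = refl
  free-insert (u ∷ U) (suc j) Uj =
    trans (sym (+-suc ([ not u ]· 1) (free (⁅ j ⁆ ∪ U)))) (cong ([ not u ]· 1 +_) (free-insert U j Uj))

  free-⊥ : ∀ r → free (⊥ {n = r}) ≡ r
  free-⊥ zero = refl
  free-⊥ (suc r) = cong suc (free-⊥ r)

  -- q complete rows: choose the k matched rows, then place them injectively.
  avoiding-complete : ∀ {r} q k (U : Subset r) → avoiding k U (replicate q ⊤) ≡ choose q k * falling (free U) k
  avoiding-complete zero zero U = refl
  avoiding-complete zero (suc k) U = refl
  avoiding-complete (suc q) zero U = refl
  avoiding-complete {r} (suc q) (suc k) U = begin
    avoiding (suc k) U (replicate q ⊤) + sum (λ j → [ available ⊤ U j ]· avoiding k (⁅ j ⁆ ∪ U) (replicate q ⊤))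
      ≡⟨ cong₂ _+_ (avoiding-complete q (suc k) U) (sum-cong-≗ {r} termwise) ⟩
    choose q (suc k) * falling (free U) (suc k) + sum (λ j → [ not (lookup U j) ]· 1 * X)
      ≡⟨ cong (choose q (suc k) * falling (free U) (suc k) +_)
           (trans (sum-cong-≗ {r} (λ j → *-comm ([ not (lookup U j) ]· 1) X))
             (trans (sym (*-distribˡ-sum {r} X _)) (*-comm X (free U)))) ⟩
    choose q (suc k) * falling (free U) (suc k) + free U * X
      ≡⟨ pascal (free U) ⟩
    choose (suc q) (suc k) * falling (free U) (suc k) ∎
    where
    open ≡-Reasoning
    X = choose q k * falling (pred (free U)) k
    termwise : ∀ j → [ available ⊤ U j ]· avoiding k (⁅ j ⁆ ∪ U) (replicate q ⊤) ≡ [ not (lookup U j) ]· 1 * X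
    termwise j rewrite lookup-replicate j true with lookup U j in Uj
    ... | true = refl
    ... | false = trans (avoiding-complete q k (⁅ j ⁆ ∪ U))
                    (trans (cong (λ s → choose q k * falling (pred s) k) (free-insert U j Uj)) (sym (+-identityʳ _)))
    pascal : ∀ s → choose q (suc k) * falling s (suc k) + s * (choose q k * falling (pred s) k)
                   ≡ choose (suc q) (suc k) * falling s (suc k)
    pascal zero = trans (+-identityʳ _) (trans (*-zeroʳ (choose q (suc k))) (sym (*-zeroʳ (choose (suc q) (suc k)))))
    pascal (suc s) = regroup s (choose q (suc k)) (choose q k) (falling s k)
      where
      regroup : ∀ s a b F → a * (suc s * F) + suc s * (b * F) ≡ (b + a) * (suc s * F)
      regroup = solve-∀

  partial : ∀ {r} → ℕ → Subset r
  partial c = tabulate (λ j → toℕ j <ᵇ c)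

  sum-partial : ∀ r c X → c ≤ r → sum {r} (λ j → [ toℕ j <ᵇ c ]· X) ≡ c * X
  sum-partial r zero X _ = sum-zero {r} (λ j → refl)
  sum-partial (suc r) (suc c) X (s≤s c≤r) = cong (X +_) (sum-partial r c X c≤r)

  avoiding-partial : ∀ {r} q c k → c ≤ r → avoiding {r} k ⊥ (partial c ∷ replicate q ⊤) ≡ lexCount r k q c
  avoiding-partial q c zero c≤r = refl
  avoiding-partial {r} q c (suc k) c≤r = cong₂ _+_
    (trans (avoiding-complete {r} q (suc k) ⊥) (cong (λ s → choose q (suc k) * falling s (suc k)) (free-⊥ r)))
    (trans (sum-cong-≗ {r} termwise) (sum-partial r c Y c≤r))
    where
    Y = choose q k * falling (pred r) k
    termwise : ∀ j → [ available (partial c) ⊥ j ]· avoiding k (⁅ j ⁆ ∪ ⊥) (replicate q ⊤) ≡ [ toℕ j <ᵇ c ]· Y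
    termwise j rewrite lookup∘tabulate (λ j → toℕ j <ᵇ c) j | lookup-replicate j false
                     | avoiding-complete q k (⁅ j ⁆ ∪ ⊥) with toℕ j <ᵇ c
    ... | false = refl
    ... | true = cong (λ s → choose q k * falling (pred s) k)
                   (trans (free-insert ⊥ j (lookup-replicate j false)) (free-⊥ r))

  tabulate-const : ∀ n (x : Bool) → tabulate {n = n} (λ _ → x) ≡ replicate n x
  tabulate-const zero x = refl
  tabulate-const (suc n) x = cong (x ∷_) (tabulate-const n x)

  partial-then-complete : ∀ {r} c {m n} → m ≡ n → (partial {r} c ∷ replicate m ⊤) ≈ᵐ (partial c ∷ replicate n ⊤)
  partial-then-complete c refl k U = refl

  lexRow : ∀ {r} → ℕ → ℕ → ℕ → Subset r
  lexRow q c i = tabulate (λ j → (i <ᵇ q) ∨ ((i ≡ᵇ q) ∧ (toℕ j <ᵇ c)))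

  lexRow-complete : ∀ {r} q c i → i < q → lexRow {r} q c i ≡ ⊤
  lexRow-complete {r} q c i i<q =
    trans (tabulate-cong (λ j → cong (_∨ ((i ≡ᵇ q) ∧ (toℕ j <ᵇ c))) (dec-true (i <? q) i<q))) (tabulate-const r true)

  lexRow-partial : ∀ {r} q c → lexRow {r} q c q ≡ partial c
  lexRow-partial q c = tabulate-cong (λ j →
    cong₂ (λ a b → a ∨ (b ∧ (toℕ j <ᵇ c))) (dec-false (q <? q) (n≮n q)) (dec-true (q ≟ q) refl))

  lexRow-empty : ∀ {r} q c i → q < i → lexRow {r} q c i ≡ ⊥
  lexRow-empty {r} q c i q<i = trans (tabulate-cong (λ j →
    cong₂ (λ a b → a ∨ (b ∧ (toℕ j <ᵇ c))) (dec-false (i <? q) (<⇒≯ q<i)) (dec-false (i ≟ q) (>⇒≢ q<i))))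
    (tabulate-const r false)

  lexRows : ∀ {r} → ℕ → ℕ → ℕ → (ℓ : ℕ) → Vec (Subset r) ℓ
  lexRows q c s ℓ = tabulate (λ i → lexRow q c (s + toℕ i))

  lexRows-step : ∀ {r} q c s ℓ → lexRows {r} q c s (suc ℓ) ≡ lexRow q c s ∷ lexRows q c (suc s) ℓ
  lexRows-step q c s ℓ =
    cong₂ _∷_ (cong (lexRow q c) (+-identityʳ s)) (tabulate-cong (λ i → cong (lexRow q c) (+-suc s (toℕ i))))

  lexRows-empty : ∀ {r} q c s ℓ → q < s → lexRows {r} q c s ℓ ≈ᵐ ([] {A = Subset r})
  lexRows-empty q c s zero q<s = λ k U → refl
  lexRows-empty q c s (suc ℓ) q<s =
    ≈ᵐ-trans (≈ᵐ-reflexive (trans (lexRows-step q c s ℓ) (cong (_∷ lexRows q c (suc s) ℓ) (lexRow-empty q c s q<s))))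
      (≈ᵐ-trans (≈ᵐ-emptyRow (lexRows q c (suc s) ℓ)) (lexRows-empty q c (suc s) ℓ (m<n⇒m<1+n q<s)))

  lexRows-complete : ∀ {r} q c s ℓ → s + ℓ ≤ q → lexRows {r} q c s ℓ ≡ replicate ℓ ⊤
  lexRows-complete q c s zero _ = refl
  lexRows-complete q c s (suc ℓ) s+ℓ≤q = trans (lexRows-step q c s ℓ)
    (cong₂ _∷_ (lexRow-complete q c s (≤-trans (s≤s (m≤m+n s ℓ)) (≤-trans (≤-reflexive (sym (+-suc s ℓ))) s+ℓ≤q)))
               (lexRows-complete q c (suc s) ℓ (≤-trans (≤-reflexive (sym (+-suc s ℓ))) s+ℓ≤q)))

  lexRows-partial : ∀ {r} q c s ℓ → s ≤ q → q < s + ℓ → lexRows {r} q c s ℓ ≈ᵐ (partial c ∷ replicate (q ∸ s) ⊤)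
  lexRows-partial q c s zero s≤q q<s = contradiction (≤-trans q<s (≤-reflexive (+-identityʳ s))) (<⇒≱ (s≤s s≤q))
  lexRows-partial q c s (suc ℓ) s≤q q<s+ℓ with s <? q
  ... | yes s<q =
    ≈ᵐ-trans (≈ᵐ-reflexive (trans (lexRows-step q c s ℓ) (cong (_∷ lexRows q c (suc s) ℓ) (lexRow-complete q c s s<q))))
    (≈ᵐ-trans (≈ᵐ-cons ⊤ (lexRows-partial q c (suc s) ℓ s<q (subst (q <_) (+-suc s ℓ) q<s+ℓ)))
    (≈ᵐ-trans (λ k U → avoiding-swap k U ⊤ (partial c) (replicate (q ∸ suc s) ⊤))
      (partial-then-complete c (sym (+-∸-assoc 1 s<q)))))
  ... | no s≮q with ≤-antisym s≤q (≮⇒≥ s≮q)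
  ...   | refl =
    ≈ᵐ-trans (≈ᵐ-reflexive (trans (lexRows-step q c q ℓ) (cong (_∷ lexRows q c (suc q) ℓ) (lexRow-partial q c))))
    (≈ᵐ-trans (≈ᵐ-cons (partial c) (lexRows-empty q c (suc q) ℓ ≤-refl))
      (partial-then-complete c (sym (n∸n≡0 q))))

  -- The lex graph L_{ℓ,r+1}(e) realises lexMatchings: its rows are q = ⌊e/(r+1)⌋ complete
  -- rows and a partial row of c = e mod (r+1) edges (which is empty when q = ℓ).
  avoiding-Lex : ∀ ℓ r e → e ≤ ℓ * suc r → ∀ k → avoiding k ⊥ (Lex ℓ (suc r) e) ≡ lexMatchings r k e
  avoiding-Lex ℓ r e e≤ k with e / suc r <? ℓ
  ... | yes q<ℓ = trans (lexRows-partial q c 0 ℓ z≤n q<ℓ k ⊥) (avoiding-partial q c k (<⇒≤ (m%n<n e (suc r))))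
    where
    q = e / suc r
    c = e % suc r
  ... | no q≮ℓ = begin
    avoiding k ⊥ (Lex ℓ (suc r) e)             ≡⟨ cong (avoiding k ⊥) (lexRows-complete q c 0 ℓ (≮⇒≥ q≮ℓ)) ⟩
    avoiding k ⊥ (replicate ℓ ⊤)               ≡⟨ cong (λ n → avoiding k ⊥ (replicate n ⊤)) ℓ≡q ⟩
    avoiding k ⊥ (replicate q ⊤)               ≡⟨ ≈ᵐ-emptyRow (replicate q ⊤) k ⊥ ⟨
    avoiding k ⊥ (⊥ ∷ replicate q ⊤)           ≡⟨ cong (λ row → avoiding k ⊥ (row ∷ replicate q ⊤)) partial-empty ⟨
    avoiding k ⊥ (partial c ∷ replicate q ⊤)   ≡⟨ avoiding-partial q c k (<⇒≤ (m%n<n e (suc r))) ⟩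
    lexMatchings r k e                          ∎
    where
    open ≡-Reasoning
    q = e / suc r
    c = e % suc r
    ℓ≡q : ℓ ≡ q
    ℓ≡q = ≤-antisym (≮⇒≥ q≮ℓ) (quotient-bound r q ℓ e c (m≡m%n+[m/n]*n e (suc r)) (≤-trans e≤ (≤-reflexive (*-comm ℓ (suc r)))))
    c≡0 : c ≡ 0
    c≡0 = remainder-zero r q e c (m≡m%n+[m/n]*n e (suc r))
            (≤-trans e≤ (≤-reflexive (trans (*-comm ℓ (suc r)) (cong (suc r *_) ℓ≡q))))
    partial-empty : partial {suc r} c ≡ ⊥
    partial-empty = trans (cong partial c≡0) (tabulate-const (suc r) false)

-- The extremal inequality, by induction on the number of rows.
module Extremality where
  open import Data.Nat
  open import Data.Nat.Properties
  open import Data.Bool using (Bool; true; false)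
  open import Data.Fin using (Fin; zero; suc; toℕ)
  open import Data.Fin.Subset using (Subset; ⊥)
  open import Data.Vec using (Vec; []; _∷_; lookup; removeAt)
  open import Data.List using ([]; _∷_; length; filterᵇ)
  open import Data.Vec.Relation.Unary.All using (All; []; _∷_)
  open import Data.Product using (Σ; _,_)
  open import Relation.Nullary using (yes; no)
  open import Relation.Binary.PropositionalEquality using (_≡_; refl; sym; trans; cong; cong₂; subst; subst₂)
  open import Data.Vec.Relation.Unary.All.Properties using (lookup⁺)

  open Sums
  open LexCounting
  open AvoidingMatchings

  BoundedBy : ℕ → ∀ {r ℓ} → Vec (Subset r) ℓ → Set
  BoundedBy D = All (λ row → countTrue row ≤ D)

  BoundedBy-weaken : ∀ {D D' r ℓ} {G : Vec (Subset r) ℓ} → D ≤ D' → BoundedBy D G → BoundedBy D' G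
  BoundedBy-weaken D≤D' [] = []
  BoundedBy-weaken D≤D' (p ∷ ps) = ≤-trans p D≤D' ∷ BoundedBy-weaken D≤D' ps

  edges-bound : ∀ {D r ℓ} {G : Vec (Subset r) ℓ} → BoundedBy D G → edges G ≤ ℓ * D
  edges-bound [] = z≤n
  edges-bound (p ∷ ps) = +-mono-≤ p (edges-bound ps)

  countTrue≤ : ∀ {n} (v : Vec Bool n) → countTrue v ≤ n
  countTrue≤ [] = z≤n
  countTrue≤ (true ∷ v) = s≤s (countTrue≤ v)
  countTrue≤ (false ∷ v) = m≤n⇒m≤1+n (countTrue≤ v)

  BoundedBy-width : ∀ {r ℓ} (G : Vec (Subset r) ℓ) → BoundedBy r G
  BoundedBy-width [] = []
  BoundedBy-width (row ∷ G) = countTrue≤ row ∷ BoundedBy-width G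

  BoundedBy-removeAt : ∀ {D r n} {G : Vec (Subset r) (suc n)} i → BoundedBy D G → BoundedBy D (removeAt G i)
  BoundedBy-removeAt zero (p ∷ ps) = ps
  BoundedBy-removeAt {G = _ ∷ _ ∷ _} (suc i) (p ∷ ps) = p ∷ BoundedBy-removeAt i ps

  edges-removeAt : ∀ {r n} (G : Vec (Subset r) (suc n)) i → edges G ≡ countTrue (lookup G i) + edges (removeAt G i)
  edges-removeAt (row ∷ G) zero = refl
  edges-removeAt (row ∷ G@(_ ∷ _)) (suc i) = begin
    countTrue row + edges G                               ≡⟨ cong (countTrue row +_) (edges-removeAt G i) ⟩
    countTrue row + (countTrue (lookup G i) + edges (removeAt G i)) ≡⟨ +-assoc (countTrue row) _ _ ⟨
    countTrue row + countTrue (lookup G i) + edges (removeAt G i) ≡⟨ cong (_+ edges (removeAt G i)) (+-comm (countTrue row) _) ⟩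
    countTrue (lookup G i) + countTrue row + edges (removeAt G i) ≡⟨ +-assoc (countTrue (lookup G i)) _ _ ⟩
    countTrue (lookup G i) + (countTrue row + edges (removeAt G i)) ∎
    where open Relation.Binary.PropositionalEquality.≡-Reasoning

  maxRow : ∀ {r n} (G : Vec (Subset r) (suc n)) → Σ (Fin (suc n)) λ i → BoundedBy (countTrue (lookup G i)) G
  maxRow (row ∷ []) = zero , ≤-refl ∷ []
  maxRow (row ∷ G@(_ ∷ _)) with maxRow G
  ... | i , bounded with countTrue (lookup G i) ≤? countTrue row
  ...   | yes ≤row = zero , ≤-refl ∷ BoundedBy-weaken ≤row bounded
  ...   | no ≰row = suc i , <⇒≤ (≰⇒> ≰row) ∷ bounded

  degree-⊥ : ∀ {r} (row : Subset r) → degree row ⊥ ≡ countTrue row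
  degree-⊥ [] = refl
  degree-⊥ (true ∷ row) = cong suc (degree-⊥ row)
  degree-⊥ (false ∷ row) = degree-⊥ row

  addRow-dominates : ∀ {r ℓ} d (row : Subset r) (G : Vec (Subset r) ℓ) j →
    (∀ k → lexMatchings d k (edges G) ≤ avoiding k ⊥ G) →
    lexMatchings d (suc j) (edges G) + (countTrue row ∸ j) * lexMatchings d j (edges G) ≤ avoiding (suc j) ⊥ (row ∷ G)
  addRow-dominates d row G j dominated = begin
    lexMatchings d (suc j) (edges G) + (countTrue row ∸ j) * lexMatchings d j (edges G)
      ≤⟨ +-mono-≤ (dominated (suc j)) (*-monoʳ-≤ (countTrue row ∸ j) (dominated j)) ⟩
    avoiding (suc j) ⊥ G + (countTrue row ∸ j) * avoiding j ⊥ G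
      ≡⟨ cong (λ x → avoiding (suc j) ⊥ G + (x ∸ j) * avoiding j ⊥ G) (degree-⊥ row) ⟨
    avoiding (suc j) ⊥ G + (degree row ⊥ ∸ j) * avoiding j ⊥ G
      ≤⟨ avoiding-addRow j ⊥ row G ⟩
    avoiding (suc j) ⊥ (row ∷ G) ∎
    where open ≤-Reasoning

  LexMinimal : ∀ {r ℓ} → Vec (Subset r) ℓ → Set
  LexMinimal {ℓ = ℓ} G = ∀ d → ℓ ≤ suc d → BoundedBy (suc d) G → ∀ k → lexMatchings d k (edges G) ≤ avoiding k ⊥ G

  -- Adding a row of maximum degree M to a lex-minimal graph with ℓ rows, case ℓ < M:
  -- compare with the lex graph on M right vertices, where the new row is complete.
  addRow-wide : ∀ {r ℓ} d m (row : Subset r) (rest : Vec (Subset r) ℓ) j →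
    countTrue row ≡ suc m → suc ℓ ≤ suc m → m ≤ d → BoundedBy (suc m) rest → LexMinimal rest →
    lexMatchings d (suc j) (edges (row ∷ rest)) ≤ avoiding (suc j) ⊥ (row ∷ rest)
  addRow-wide {ℓ = ℓ} d m row rest j M≡ ℓ<M m≤d restBounded IH = begin
    lexMatchings d (suc j) (M + e)     ≤⟨ lexMatchings-antitone m d (suc j) (M + e) m≤d M+e≤ ⟩
    lexMatchings m (suc j) (M + e)     ≡⟨ cong (lexMatchings m (suc j)) (trans (+-comm M e) (cong (e +_) M≡)) ⟩
    lexMatchings m (suc j) (e + suc m) ≡⟨ lexMatchings-addRow m j e ⟩
    lexMatchings m (suc j) e + (suc m ∸ j) * lexMatchings m j e
      ≡⟨ cong (λ x → lexMatchings m (suc j) e + (x ∸ j) * lexMatchings m j e) M≡ ⟨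
    lexMatchings m (suc j) e + (M ∸ j) * lexMatchings m j e
      ≤⟨ addRow-dominates m row rest j (IH m (m≤n⇒m≤1+n (≤-pred ℓ<M)) restBounded) ⟩
    avoiding (suc j) ⊥ (row ∷ rest)    ∎
    where
    open ≤-Reasoning
    M = countTrue row
    e = edges rest
    M+e≤ : M + e ≤ suc m * suc m
    M+e≤ = begin
      M + e             ≤⟨ +-monoʳ-≤ M (edges-bound restBounded) ⟩
      M + ℓ * suc m     ≡⟨ cong (λ x → x + ℓ * suc m) M≡ ⟩
      suc ℓ * suc m     ≤⟨ *-monoˡ-≤ (suc m) ℓ<M ⟩
      suc m * suc m     ∎

  -- Case M ≤ ℓ: compare with the lex graph on ℓ right vertices (ℓ - 1 before the new row).
  addRow-narrow : ∀ {r ℓ} d (row : Subset r) (rest : Vec (Subset r) ℓ) j →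
    countTrue row ≤ ℓ → ℓ ≤ d → BoundedBy (countTrue row) rest → LexMinimal rest →
    lexMatchings d (suc j) (edges (row ∷ rest)) ≤ avoiding (suc j) ⊥ (row ∷ rest)
  addRow-narrow d row [] j M≤0 _ _ _ =
    ≤-trans (≤-reflexive (trans (cong (lexMatchings d (suc j)) (trans (+-identityʳ _) (n≤0⇒n≡0 M≤0)))
      (lexMatchings-empty d j))) z≤n
  addRow-narrow {ℓ = suc n} d row rest j M≤ℓ ℓ≤d restBounded IH = begin
    lexMatchings d (suc j) (M + e)        ≤⟨ lexMatchings-antitone (suc n) d (suc j) (M + e) ℓ≤d M+e≤ ⟩
    lexMatchings (suc n) (suc j) (M + e)  ≡⟨ cong (lexMatchings (suc n) (suc j)) (+-comm M e) ⟩
    lexMatchings (suc n) (suc j) (e + M)  ≤⟨ lexMatchings-extend n M e j M≤ℓ (edges-bound restBounded) ⟩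
    lexMatchings n (suc j) e + (M ∸ j) * lexMatchings n j e
      ≤⟨ addRow-dominates n row rest j (IH n ≤-refl (BoundedBy-weaken M≤ℓ restBounded)) ⟩
    avoiding (suc j) ⊥ (row ∷ rest)       ∎
    where
    open ≤-Reasoning
    M = countTrue row
    e = edges rest
    M+e≤ : M + e ≤ suc (suc n) * suc (suc n)
    M+e≤ = begin
      M + e                 ≤⟨ +-monoʳ-≤ M (edges-bound restBounded) ⟩
      suc (suc n) * M       ≤⟨ *-monoʳ-≤ (suc (suc n)) (m≤n⇒m≤1+n M≤ℓ) ⟩
      suc (suc n) * suc (suc n) ∎

  addMaxRow : ∀ {r ℓ} (row : Subset r) (rest : Vec (Subset r) ℓ) →
    BoundedBy (countTrue row) rest → LexMinimal rest → LexMinimal (row ∷ rest)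
  addMaxRow row rest restBounded IH d ℓ≤d bounded zero = ≤-refl
  addMaxRow {ℓ = ℓ} row rest restBounded IH d ℓ≤d (M≤d ∷ _) (suc j) with suc ℓ ≤? countTrue row
  ... | no ℓ≮M = addRow-narrow d row rest j (≤-pred (≰⇒> ℓ≮M)) (≤-pred ℓ≤d) restBounded IH
  ... | yes ℓ<M = wide (countTrue row) refl ℓ<M
    where
    wide : ∀ M → countTrue row ≡ M → suc ℓ ≤ M →
           lexMatchings d (suc j) (edges (row ∷ rest)) ≤ avoiding (suc j) ⊥ (row ∷ rest)
    wide (suc m) M≡ ℓ<M = addRow-wide d m row rest j M≡ ℓ<M (≤-pred (subst (_≤ suc d) M≡ M≤d))
                            (subst (λ x → BoundedBy x rest) M≡ restBounded) IH

  -- Every graph with ℓ rows is lex-minimal: induct on ℓ, splitting off a row of maximum degree.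
  lex-minimal : ∀ {r} ℓ (G : Vec (Subset r) ℓ) → LexMinimal G
  lex-minimal zero [] d _ _ zero = ≤-refl
  lex-minimal zero [] d _ _ (suc j) = ≤-reflexive (lexMatchings-empty d j)
  lex-minimal (suc ℓ) G d ℓ≤d bounded k with maxRow G
  ... | i , maximal =
    subst₂ _≤_ (cong (lexMatchings d k) (sym (edges-removeAt G i))) (sym (≈ᵐ-removeAt G i k ⊥))
      (addMaxRow (lookup G i) (removeAt G i) (BoundedBy-removeAt i maximal) (lex-minimal ℓ (removeAt G i))
        d ℓ≤d (lookup⁺ bounded i ∷ BoundedBy-removeAt i bounded) k)

  sum-indicator : ∀ K n → n ≤ K → sum {suc K} (λ t → [ n ≡ᵇ toℕ t ]· 1) ≡ 1
  sum-indicator K zero _ = cong suc (sum-zero {K} (λ _ → refl))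
  sum-indicator (suc K) (suc n) (s≤s n≤K) = sum-indicator K n n≤K

  length-split : ∀ {A : Set} (g : A → ℕ) K → (∀ x → g x ≤ K) → ∀ xs →
    length xs ≡ sum {suc K} (λ t → length (filterᵇ (λ x → g x ≡ᵇ toℕ t) xs))
  length-split g K g≤K [] = sym (sum-zero {suc K} (λ _ → refl))
  length-split g K g≤K (x ∷ xs) = begin
    suc (length xs)
      ≡⟨ cong₂ _+_ (sym (sum-indicator K (g x) (g≤K x))) (length-split g K g≤K xs) ⟩
    sum {suc K} (λ t → [ g x ≡ᵇ toℕ t ]· 1) + sum {suc K} (λ t → length (filterᵇ (λ x → g x ≡ᵇ toℕ t) xs))
      ≡⟨ ∑-distrib-+ {suc K} (λ t → [ g x ≡ᵇ toℕ t ]· 1) (λ t → length (filterᵇ (λ x → g x ≡ᵇ toℕ t) xs)) ⟨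
    sum {suc K} (λ t → [ g x ≡ᵇ toℕ t ]· 1 + length (filterᵇ (λ x → g x ≡ᵇ toℕ t) xs))
      ≡⟨ sum-cong-≗ {suc K} termwise ⟩
    sum {suc K} (λ t → length (filterᵇ (λ x → g x ≡ᵇ toℕ t) (x ∷ xs))) ∎
    where
    open Relation.Binary.PropositionalEquality.≡-Reasoning
    termwise : ∀ t → [ g x ≡ᵇ toℕ t ]· 1 + length (filterᵇ (λ x → g x ≡ᵇ toℕ t) xs)
                     ≡ length (filterᵇ (λ x → g x ≡ᵇ toℕ t) (x ∷ xs))
    termwise t with g x ≡ᵇ toℕ t
    ... | true = refl
    ... | false = refl

  m-split : ∀ {ℓ r} (G : BipGraph ℓ r) → m G ≡ sum {suc (ℓ * r)} (λ k → mk (toℕ k) G)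
  m-split {ℓ} {r} G = length-split edges (ℓ * r) (λ M → edges-bound (BoundedBy-width M)) (matchings G)

open Sums using (sum-mono)
open LexCounting using (lexMatchings)
open AvoidingMatchings using (avoiding)
open Enumeration using (mk≡avoiding)
open LexGraph using (avoiding-Lex)
open Extremality using (edges-bound; BoundedBy-width; lex-minimal; m-split)

mk-Lex≤mk : ∀ k ℓ r (B : BipGraph ℓ (suc r)) → ℓ ≤ suc r → mk k (Lex ℓ (suc r) (edges B)) ≤ mk k B
mk-Lex≤mk k ℓ r B ℓ≤r = begin
  mk k (Lex ℓ (suc r) (edges B))         ≡⟨ mk≡avoiding k (Lex ℓ (suc r) (edges B)) ⟩
  avoiding k ⊥ (Lex ℓ (suc r) (edges B)) ≡⟨ avoiding-Lex ℓ r (edges B) (edges-bound (BoundedBy-width B)) k ⟩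
  lexMatchings r k (edges B)             ≤⟨ lex-minimal ℓ B r ℓ≤r (BoundedBy-width B) k ⟩
  avoiding k ⊥ B                         ≡⟨ mk≡avoiding k B ⟨
  mk k B                                 ∎
  where open ≤-Reasoning

theorem1p3 : (k ℓ r e : ℕ) → 1 ≤ k → k ≤ ℓ → ℓ ≤ r → e ≤ ℓ * r →
    (B : BipGraph ℓ r) → edges B ≡ e →
    (m (Lex ℓ r e) ≤ m B) × (mk k (Lex ℓ r e) ≤ mk k B)
-- With no right vertices, 1 ≤ k ≤ ℓ ≤ r is impossible.
theorem1p3 k ℓ zero e 1≤k k≤ℓ ℓ≤0 _ B _ = contradiction (≤-trans 1≤k (≤-trans k≤ℓ ℓ≤0)) λ ()
theorem1p3 k ℓ (suc r) e _ _ ℓ≤r _ B refl =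
  subst₂ _≤_ (sym (m-split (Lex ℓ (suc r) (edges B)))) (sym (m-split B))
    (sum-mono {suc (ℓ * suc r)} (λ t → mk-Lex≤mk (toℕ t) ℓ r B ℓ≤r)) ,
  mk-Lex≤mk k ℓ r B ℓ≤r
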